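{- For every $n\ge1$, $|\mathrm{Sort}_n(\mathfrak{s}_{1\underline{32}})|=C_n$, the $n$-th Catalan number.
   Context: $C_n=\frac{1}{n+1}\binom{2n}{n}$. A pattern is a permutation $\sigma$ in which some blocks of consecutive entries may be underlined; a sequence contains it if it has a subsequence order-isomorphic to $\sigma$ whose entries corresponding to a common underlined block are adjacent in the sequence. Pattern-avoiding stack map $\mathfrak{s}_\sigma$: process input $\tau_1,\dots,\tau_n$ in order; when $\tau_i$ is next, while the stack is nonempty and the sequence formed by placing $\tau_i$ on top of the stack, read top to bottom, contains $\sigma$ (underlined entries adjacent in the stack), pop the top entry to the output; then push $\tau_i$; at the end pop all remaining entries top to bottom to the output. West's stack-sorting map $s$ pushes each input entry after popping all smaller stack entries to the output, emptying the stack at the end. $\mathrm{Sort}_n(\mathfrak{s}_\sigma)=\{\tau\in\mathfrak S_n: s(\mathfrak{s}_\sigma(\tau))=12\cdots n\}$. -}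

module Defs where

open import Data.Nat using (ℕ; zero; suc; _<ᵇ_; _≡ᵇ_; _/_)
open import Data.Nat.Combinatorics using (_C_)
open import Data.Bool using (Bool; true; false; if_then_else_; _∧_; not; _xor_)
open import Data.List using (List; []; _∷_; [_]; _++_; length; take; drop; concat; map; concatMap; zip; all; any; upTo)
open import Data.Product using (_×_; _,_; proj₁; proj₂)

-- A pattern: a permutation (of 1..k) written as a list of consecutive blocks;
-- entries in a common block are the underlined (adjacency-required) ones,
-- non-underlined entries form singleton blocks.
Pattern : Set
Pattern = List (List ℕ)

pat1-32 : Pattern
pat1-32 = [ 1 ] ∷ (3 ∷ 2 ∷ []) ∷ []

orderIso : List ℕ → List ℕ → Bool
orderIso xs ps =
  (length xs ≡ᵇ length ps) ∧
  all (λ a → all (λ b → not ((proj₁ a <ᵇ proj₁ b) xor (proj₂ a <ᵇ proj₂ b))) zs) zs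
  where zs = zip xs ps

tails : List ℕ → List (List ℕ)
tails [] = [ [] ]
tails (x ∷ xs) = (x ∷ xs) ∷ tails xs

occs : Pattern → List ℕ → List (List ℕ)
occs [] w = [ [] ]
occs (b ∷ bs) w = concatMap step (tails w)
  where
  k = length b
  step : List ℕ → List (List ℕ)
  step w' = if length (take k w') ≡ᵇ k
            then map (take k w' ++_) (occs bs (drop k w'))
            else []

contains : Pattern → List ℕ → Bool
contains p w = any (λ o → orderIso o (concat p)) (occs p w)

-- one step of the pattern-avoiding stack map: stack is read top first
popWhileP : Pattern → ℕ → List ℕ → List ℕ → List ℕ × List ℕ
popWhileP p x [] out = [] , out
popWhileP p x (y ∷ st) out =
  if contains p (x ∷ y ∷ st) then popWhileP p x st (out ++ [ y ]) else (y ∷ st , out)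

runP : Pattern → List ℕ → List ℕ → List ℕ → List ℕ
runP p st out [] = out ++ st
runP p st out (x ∷ xs) with popWhileP p x st out
... | st' , out' = runP p (x ∷ st') out' xs

stackMap : Pattern → List ℕ → List ℕ
stackMap p τ = runP p [] [] τ

popSmaller : ℕ → List ℕ → List ℕ → List ℕ × List ℕ
popSmaller x [] out = [] , out
popSmaller x (y ∷ st) out =
  if y <ᵇ x then popSmaller x st (out ++ [ y ]) else (y ∷ st , out)

runW : List ℕ → List ℕ → List ℕ → List ℕ
runW st out [] = out ++ st
runW st out (x ∷ xs) with popSmaller x st out
... | st' , out' = runW (x ∷ st') out' xs

westSort : List ℕ → List ℕ
westSort τ = runW [] [] τ

idPerm : ℕ → List ℕ
idPerm n = map suc (upTo n)

catalan : ℕ → ℕ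
catalan n = ((n Data.Nat.+ n) C n) / suc n

{-# OPTIONS --safe #-}

-- While the entries output so far are decreasing, the stack of s_{1-32} is a block Y above an
-- increasing run m ∷ M' starting at the stack minimum m, and out ++ Y is decreasing. An entry
-- x < m pops exactly Y (x, the last entry of Y and m form a 1-32); a larger entry is pushed without
-- popping if it lies between the top of Y and the last output entry, and otherwise it creates an
-- ascent among the entries above m, which persists. So s_{1-32}(τ) = D ++ m ∷ M' with D above m,
-- and West's map sorts this exactly when D is decreasing: an ascent in D makes it output an entry
-- of D, larger than 1, first. The automaton good tracks whether D stays decreasing. Removing the
-- maximum n+1 from a good permutation leaves a good one, in which n+1 stood either in front or
-- right after the increasing run starting at its j-th entry, for some j ≤ k, the length of its
-- initial descending run; the new run length is k+1, respectively j. This is the Catalan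
-- generating tree (k) → (1)(2)…(k+1), whose n-th level has C(2n,n) − C(2n,n−1) nodes.

module Submission where

open import Defs
open import Data.Bool using (Bool; true; false; _∧_; _∨_; T; if_then_else_)
open import Data.Bool.ListAction using (any)
open import Data.Bool.Properties using (T-≡; ∨-zeroʳ; ∧-zeroʳ)
open import Data.List using (List; []; _∷_; [_]; _++_; _∷ʳ_; map; length; drop; last; head; upTo)
open import Data.List.Properties using (++-assoc; ++-identityʳ; ∷-injectiveˡ; ∷-injectiveʳ; map-applyUpTo; map-++; length-map; length-++; length-upTo; upTo-∷ʳ)
open import Data.List.Membership.Propositional using (_∈_; _∉_)
open import Data.List.Membership.Propositional.Properties using (∈-++⁺ˡ; ∈-++⁺ʳ; ∈-++⁻; ∈-map⁺; ∈-map⁻; ∈-upTo⁻; ∈-∃++)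
open import Data.List.Relation.Unary.All as All using (All; []; _∷_)
import Data.List.Relation.Unary.All.Properties as All
open import Data.List.Relation.Unary.Any using (here; there)
open import Data.List.Relation.Unary.Linked as Linked using (Linked; []; [-]; _∷_)
import Data.List.Relation.Unary.Linked.Properties as Linkedₚ
open import Data.List.Relation.Unary.Unique.Propositional using (Unique; []; _∷_)
open import Data.List.Relation.Binary.Permutation.Propositional using (_↭_; ↭-refl; ↭-sym; ↭-trans; ↭-reflexive; ↭-prep; ↭-swap; ↭⇒↭ₛ)
open import Data.List.Relation.Binary.Permutation.Propositional.Properties using (shift; ++⁺ˡ; ∈-resp-↭; ↭-length; ¬x∷xs↭[]; ↭-empty-inv; drop-∷; ∷↭∷ʳ)
open import Data.List.Relation.Binary.Pointwise using (Pointwise-≡⇒≡)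
open import Data.List.Relation.Binary.Disjoint.Propositional using (Disjoint)
open import Data.List.Relation.Unary.Sorted.TotalOrder.Properties using (↗↭↗⇒≋)
import Data.List.Relation.Unary.Unique.Propositional.Properties as Uniqueₚ
open Uniqueₚ using (Unique[x∷xs]⇒x∉xs)
import Data.List.Relation.Binary.Permutation.Setoid.Properties as ↭ₛ
open import Data.Maybe using (Maybe; just; nothing)
open import Data.Maybe.Relation.Binary.Connected using (Connected; just; just-nothing; nothing-just; nothing)
open import Data.Nat using (ℕ; zero; suc; _+_; _*_; _/_; _<ᵇ_; _<_; _≤_; _>_; _≥_; z≤n; s≤s; s≤s⁻¹)
open import Data.Nat.Properties
open import Data.Nat.Combinatorics using (_C_; nCk+nC[k+1]≡[n+1]C[k+1])
open import Data.Nat.DivMod using (m*n/n≡m)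
open import Data.Nat.Solver using (module +-*-Solver)
open import Data.Product using (Σ; ∃-syntax; _×_; _,_; proj₁; proj₂)
open import Data.Sum using (_⊎_; inj₁; inj₂)
open import Data.Unit using (⊤; tt)
open import Function.Base using (_∘_)
open import Function.Bundles using (_⇔_; mk⇔; Equivalence)
open import Relation.Binary.PropositionalEquality hiding ([_])
open import Relation.Nullary using (contradiction; yes; no)
open import Relation.Nullary.Reflects using (ofʸ; ofⁿ)

<⇒<ᵇ≡true : ∀ {m n} → m < n → (m <ᵇ n) ≡ true
<⇒<ᵇ≡true m<n = Equivalence.to T-≡ (<⇒<ᵇ m<n)

≥⇒<ᵇ≡false : ∀ {m n} → n ≤ m → (m <ᵇ n) ≡ false
≥⇒<ᵇ≡false {m} {n} n≤m with m <ᵇ n | <ᵇ-reflects-< m n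
... | false | _ = refl
... | true | ofʸ m<n = contradiction n≤m (<⇒≱ m<n)

<ᵇ≡true⇒< : ∀ m n → (m <ᵇ n) ≡ true → m < n
<ᵇ≡true⇒< m n e = <ᵇ⇒< m n (Equivalence.from T-≡ e)

<ᵇ≡false⇒≥ : ∀ m n → (m <ᵇ n) ≡ false → n ≤ m
<ᵇ≡false⇒≥ m n e = ≮⇒≥ (λ m<n → subst T e (<⇒<ᵇ m<n))

Increasing Decreasing Sorted : List ℕ → Set
Increasing = Linked _<_
Decreasing = Linked _>_
Sorted = Linked _≤_

decreasing⇒below-head : ∀ {x r} → Decreasing (x ∷ r) → All (_< x) r
decreasing⇒below-head [-] = []
decreasing⇒below-head (x>y ∷ d) = Linkedₚ.Linked⇒All (λ p q → <-trans q p) x>y d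

sorted⇒above-head : ∀ {x r} → Sorted (x ∷ r) → All (x ≤_) r
sorted⇒above-head [-] = []
sorted⇒above-head (x≤y ∷ s) = Linkedₚ.Linked⇒All ≤-trans x≤y s

decreasing-++⁻ʳ : ∀ xs {ys} → Decreasing (xs ++ ys) → Decreasing ys
decreasing-++⁻ʳ [] d = d
decreasing-++⁻ʳ (x ∷ xs) d = decreasing-++⁻ʳ xs (Linked.tail d)

data HasAscent : List ℕ → Set where
  here  : ∀ {x v xs} → v ∈ xs → x < v → HasAscent (x ∷ xs)
  there : ∀ {x xs} → HasAscent xs → HasAscent (x ∷ xs)

data AdjacentAscent : List ℕ → Set where
  here  : ∀ {x y r} → x < y → AdjacentAscent (x ∷ y ∷ r)
  there : ∀ {x r} → AdjacentAscent r → AdjacentAscent (x ∷ r)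

hasAscent⇒adjacentAscent : ∀ {xs} → HasAscent xs → AdjacentAscent xs
hasAscent⇒adjacentAscent (there h) = there (hasAscent⇒adjacentAscent h)
hasAscent⇒adjacentAscent (here v∈r x<v) = reach _ v∈r x<v
  where
  reach : ∀ {x v} r → v ∈ r → x < v → AdjacentAscent (x ∷ r)
  reach (y ∷ r) (here refl) x<v = here x<v
  reach {x} (y ∷ r) (there v∈r) x<v with <-≤-connex x y
  ... | inj₁ x<y = here x<y
  ... | inj₂ y≤x = there (reach r v∈r (≤-<-trans y≤x x<v))

hasAscent-++⁺ʳ : ∀ xs {ys} → HasAscent ys → HasAscent (xs ++ ys)
hasAscent-++⁺ʳ [] h = h
hasAscent-++⁺ʳ (x ∷ xs) h = there (hasAscent-++⁺ʳ xs h)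

hasAscent-insert-above : ∀ xs {u x ys} → u ∈ xs → u < x → HasAscent (xs ++ x ∷ ys)
hasAscent-insert-above (a ∷ xs) (here refl) u<x = here (∈-++⁺ʳ xs (here refl)) u<x
hasAscent-insert-above (a ∷ xs) (there u∈xs) u<x = there (hasAscent-insert-above xs u∈xs u<x)

hasAscent-insert : ∀ xs {ys} x → HasAscent (xs ++ ys) → HasAscent (xs ++ x ∷ ys)
hasAscent-insert [] x h = there h
hasAscent-insert (a ∷ xs) x (here v∈ a<v) = here (∈-insert xs v∈) a<v
  where
  ∈-insert : ∀ xs {ys v} → v ∈ xs ++ ys → v ∈ xs ++ x ∷ ys
  ∈-insert [] v∈ = there v∈
  ∈-insert (a ∷ xs) (here refl) = here refl
  ∈-insert (a ∷ xs) (there v∈) = there (∈-insert xs v∈)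
hasAscent-insert (a ∷ xs) x (there h) = there (hasAscent-insert xs x h)

unique-resp-↭ : ∀ {A : Set} {xs ys : List A} → xs ↭ ys → Unique xs → Unique ys
unique-resp-↭ {A} p = ↭ₛ.Unique-resp-↭ (setoid A) (↭⇒↭ₛ p)

unique⇒∉-prefix : ∀ {A : Set} (xs : List A) {x ys} → Unique (xs ++ x ∷ ys) → x ∉ xs
unique⇒∉-prefix (a ∷ xs) (a≢ ∷ _) (here refl) = All.lookup a≢ (∈-++⁺ʳ xs (here refl)) refl
unique⇒∉-prefix (a ∷ xs) (_ ∷ u) (there x∈xs) = unique⇒∉-prefix xs u x∈xs

-- Containment of 1-32

adjacentPairs : List ℕ → List (List ℕ)
adjacentPairs (p ∷ q ∷ r) = (p ∷ q ∷ []) ∷ adjacentPairs (q ∷ r)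
adjacentPairs _ = []

hasDescentAboveᵇ : ℕ → List ℕ → Bool
hasDescentAboveᵇ a (p ∷ q ∷ r) = ((a <ᵇ q) ∧ (q <ᵇ p)) ∨ hasDescentAboveᵇ a (q ∷ r)
hasDescentAboveᵇ a _ = false

has1-32ᵇ : List ℕ → Bool
has1-32ᵇ [] = false
has1-32ᵇ (a ∷ w) = hasDescentAboveᵇ a w ∨ has1-32ᵇ w

occs-32 : ∀ w → occs ((3 ∷ 2 ∷ []) ∷ []) w ≡ adjacentPairs w
occs-32 [] = refl
occs-32 (p ∷ []) = refl
occs-32 (p ∷ q ∷ r) = cong ((p ∷ q ∷ []) ∷_) (occs-32 (q ∷ r))

n<ᵇn≡false : ∀ n → (n <ᵇ n) ≡ false
n<ᵇn≡false n = ≥⇒<ᵇ≡false (≤-refl {n})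

orderIso-1-32 : ∀ a p q → orderIso (a ∷ p ∷ q ∷ []) (1 ∷ 3 ∷ 2 ∷ []) ≡ ((a <ᵇ q) ∧ (q <ᵇ p))
orderIso-1-32 a p q rewrite n<ᵇn≡false a | n<ᵇn≡false p | n<ᵇn≡false q
  with a <ᵇ p in ap | a <ᵇ q in aq | p <ᵇ a in pa | p <ᵇ q in pq | q <ᵇ a in qa | q <ᵇ p in qp
... | false | false | _     | _     | _     | _     = refl
... | false | true  | _     | _     | _     | false = refl
... | false | true  | _     | _     | _     | true  =
  contradiction (<-trans (<ᵇ≡true⇒< a q aq) (<ᵇ≡true⇒< q p qp)) (≤⇒≯ (<ᵇ≡false⇒≥ a p ap))
... | true  | false | _     | _     | _     | _     = refl
... | true  | true  | true  | _     | _     | _     = contradiction (<ᵇ≡true⇒< a p ap) (<⇒≯ (<ᵇ≡true⇒< p a pa))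
... | true  | true  | false | true  | _     | false = refl
... | true  | true  | false | true  | _     | true  = contradiction (<ᵇ≡true⇒< p q pq) (<⇒≯ (<ᵇ≡true⇒< q p qp))
... | true  | true  | false | false | true  | _     = contradiction (<ᵇ≡true⇒< a q aq) (<⇒≯ (<ᵇ≡true⇒< q a qa))
... | true  | true  | false | false | false | false = refl
... | true  | true  | false | false | false | true  = refl

any-++ : ∀ {A : Set} (f : A → Bool) xs ys → any f (xs ++ ys) ≡ (any f xs ∨ any f ys)
any-++ f [] ys = refl
any-++ f (x ∷ xs) ys with f x
... | true = refl
... | false = any-++ f xs ys

contains-1-32 : ∀ w → contains pat1-32 w ≡ has1-32ᵇ w
contains-1-32 [] = refl
contains-1-32 (a ∷ t) = begin
  any iso (map (a ∷_) (occs ((3 ∷ 2 ∷ []) ∷ []) t) ++ occs pat1-32 t)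
    ≡⟨ any-++ iso (map (a ∷_) (occs ((3 ∷ 2 ∷ []) ∷ []) t)) (occs pat1-32 t) ⟩
  any iso (map (a ∷_) (occs ((3 ∷ 2 ∷ []) ∷ []) t)) ∨ contains pat1-32 t
    ≡⟨ cong₂ _∨_ (cong (any iso ∘ map (a ∷_)) (occs-32 t)) (contains-1-32 t) ⟩
  any iso (map (a ∷_) (adjacentPairs t)) ∨ has1-32ᵇ t
    ≡⟨ cong (_∨ has1-32ᵇ t) (descents a t) ⟩
  has1-32ᵇ (a ∷ t) ∎
  where
  open ≡-Reasoning
  iso : List ℕ → Bool
  iso o = orderIso o (1 ∷ 3 ∷ 2 ∷ [])
  descents : ∀ a t → any iso (map (a ∷_) (adjacentPairs t)) ≡ hasDescentAboveᵇ a t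
  descents a [] = refl
  descents a (p ∷ []) = refl
  descents a (p ∷ q ∷ r) = cong₂ _∨_ (orderIso-1-32 a p q) (descents a (q ∷ r))

DescentsBelow : ℕ → List ℕ → Set
DescentsBelow a (p ∷ q ∷ r) = (q < p → q ≤ a) × DescentsBelow a (q ∷ r)
DescentsBelow a _ = ⊤

Avoids1-32 : List ℕ → Set
Avoids1-32 [] = ⊤
Avoids1-32 (a ∷ w) = DescentsBelow a w × Avoids1-32 w

avoids⇒has1-32ᵇ≡false : ∀ w → Avoids1-32 w → has1-32ᵇ w ≡ false
avoids⇒has1-32ᵇ≡false [] _ = refl
avoids⇒has1-32ᵇ≡false (a ∷ w) (below , avoids) =
  cong₂ _∨_ (noDescentAbove w below) (avoids⇒has1-32ᵇ≡false w avoids)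
  where
  notAbove : ∀ {p q} → (q < p → q ≤ a) → ((a <ᵇ q) ∧ (q <ᵇ p)) ≡ false
  notAbove {p} {q} f with a <ᵇ q | <ᵇ-reflects-< a q | q <ᵇ p | <ᵇ-reflects-< q p
  ... | false | _ | _ | _ = refl
  ... | true | _ | false | _ = refl
  ... | true | ofʸ a<q | true | ofʸ q<p = contradiction (f q<p) (<⇒≱ a<q)
  noDescentAbove : ∀ w → DescentsBelow a w → hasDescentAboveᵇ a w ≡ false
  noDescentAbove [] _ = refl
  noDescentAbove (p ∷ []) _ = refl
  noDescentAbove (p ∷ q ∷ r) (f , below) = cong₂ _∨_ (notAbove f) (noDescentAbove (q ∷ r) below)

increasing⇒descentsBelow : ∀ a {w} → Increasing w → DescentsBelow a w
increasing⇒descentsBelow a [] = tt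
increasing⇒descentsBelow a [-] = tt
increasing⇒descentsBelow a (p<q ∷ i) = (λ q<p → contradiction q<p (<-asym p<q)) , increasing⇒descentsBelow a i

increasing⇒avoids : ∀ {w} → Increasing w → Avoids1-32 w
increasing⇒avoids [] = tt
increasing⇒avoids {a ∷ w} i = increasing⇒descentsBelow a (Linked.tail i) , increasing⇒avoids (Linked.tail i)

-- The descents of Y ++ m ∷ M' lie in Y ++ [ m ], so their lower entries are m and those of drop 1 Y.
descentsBelow-valley : ∀ {a m M'} Y → All (_≤ a) (drop 1 Y) → m ≤ a → Increasing (m ∷ M') →
                       DescentsBelow a (Y ++ m ∷ M')
descentsBelow-valley [] _ _ i = increasing⇒descentsBelow _ i
descentsBelow-valley (y ∷ []) _ m≤a i = (λ _ → m≤a) , increasing⇒descentsBelow _ i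
descentsBelow-valley (y ∷ z ∷ Y) (z≤a ∷ Y≤a) m≤a i = (λ _ → z≤a) , descentsBelow-valley (z ∷ Y) Y≤a m≤a i

avoids-valley : ∀ {m M'} Y → Decreasing Y → All (m <_) Y → Increasing (m ∷ M') → Avoids1-32 (Y ++ m ∷ M')
avoids-valley [] _ _ i = increasing⇒avoids i
avoids-valley (y ∷ Y) d (m<y ∷ m<Y) i =
  descentsBelow-valley Y (All.drop⁺ 1 (All.map <⇒≤ (decreasing⇒below-head d))) (<⇒≤ m<y) i ,
  avoids-valley Y (Linked.tail d) m<Y i

push-on-valley-avoids : ∀ {x m M'} Y → Decreasing Y → All (m <_) Y → Increasing (m ∷ M') →
                        m ≤ x → All (_≤ x) (drop 1 Y) → has1-32ᵇ (x ∷ Y ++ m ∷ M') ≡ false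
push-on-valley-avoids Y d m<Y i m≤x Y≤x =
  avoids⇒has1-32ᵇ≡false _ (descentsBelow-valley Y Y≤x m≤x i , avoids-valley Y d m<Y i)

descent-above : ∀ {x p q} → x < q → q < p → ((x <ᵇ q) ∧ (q <ᵇ p)) ≡ true
descent-above x<q q<p = cong₂ _∧_ (<⇒<ᵇ≡true x<q) (<⇒<ᵇ≡true q<p)

hasDescentAboveᵇ-valley : ∀ {x m M'} y Y → x < m → All (m <_) (y ∷ Y) →
                          hasDescentAboveᵇ x ((y ∷ Y) ++ m ∷ M') ≡ true
hasDescentAboveᵇ-valley y [] x<m (m<y ∷ []) = cong (_∨ _) (descent-above x<m m<y)
hasDescentAboveᵇ-valley y (z ∷ Y) x<m (_ ∷ m<zY) =
  trans (cong (_ ∨_) (hasDescentAboveᵇ-valley z Y x<m m<zY)) (∨-zeroʳ _)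

-- Popping the stack of s_{1-32}

pop-on-1-32 : ∀ x y st out → has1-32ᵇ (x ∷ y ∷ st) ≡ true →
              popWhileP pat1-32 x (y ∷ st) out ≡ popWhileP pat1-32 x st (out ++ [ y ])
pop-on-1-32 x y st out e rewrite contains-1-32 (x ∷ y ∷ st) | e = refl

stop-on-1-32-free : ∀ x y st out → has1-32ᵇ (x ∷ y ∷ st) ≡ false →
                    popWhileP pat1-32 x (y ∷ st) out ≡ (y ∷ st , out ++ [])
stop-on-1-32-free x y st out e rewrite contains-1-32 (x ∷ y ∷ st) | e | ++-identityʳ out = refl

popWhileP-++ : ∀ p x st out {st' out'} → popWhileP p x st out ≡ (st' , out') →
               ∀ zs → out' ++ st' ++ zs ≡ out ++ st ++ zs
popWhileP-++ p x [] out refl zs = refl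
popWhileP-++ p x (y ∷ st) out e zs with contains p (x ∷ y ∷ st)
... | true = trans (popWhileP-++ p x st (out ++ [ y ]) e zs) (++-assoc out [ y ] (st ++ zs))
... | false with refl ← e = refl

runP-∷ : ∀ p x st out xs {st' out'} → popWhileP p x st out ≡ (st' , out') →
         runP p st out (x ∷ xs) ≡ runP p (x ∷ st') out' xs
runP-∷ p x st out xs e rewrite e = refl

runP-↭ : ∀ p st out xs → runP p st out xs ↭ out ++ st ++ xs
runP-↭ p st out [] = ↭-reflexive (cong (out ++_) (sym (++-identityʳ st)))
runP-↭ p st out (x ∷ xs) with popWhileP p x st out in e
... | st' , out' = ↭-trans (runP-↭ p (x ∷ st') out' xs)
  (↭-trans (++⁺ˡ out' (↭-sym (shift x st' xs))) (↭-reflexive (popWhileP-++ p x st out e (x ∷ xs))))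

unique-step : ∀ p x st out rest {st' out'} → popWhileP p x st out ≡ (st' , out') →
              Unique (out ++ st ++ x ∷ rest) → Unique (out' ++ (x ∷ st') ++ rest)
unique-step p x st out rest {st'} {out'} e u =
  unique-resp-↭ (++⁺ˡ out' (shift x st' rest)) (subst Unique (sym (popWhileP-++ p x st out e (x ∷ rest))) u)

pop-keeps-minimum : ∀ {x m M'} → has1-32ᵇ (x ∷ m ∷ M') ≡ false → ∀ Y out →
  ∃[ Y₁ ] ∃[ Y₂ ] Y ≡ Y₁ ++ Y₂ × popWhileP pat1-32 x (Y ++ m ∷ M') out ≡ (Y₂ ++ m ∷ M' , out ++ Y₁)
pop-keeps-minimum {x} {m} {M'} free [] out = [] , [] , refl , stop-on-1-32-free x m M' out free
pop-keeps-minimum {x} {m} {M'} free (y ∷ Y) out with has1-32ᵇ (x ∷ y ∷ Y ++ m ∷ M') in e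
... | true with Y₁ , Y₂ , refl , popped ← pop-keeps-minimum free Y (out ++ [ y ]) =
  y ∷ Y₁ , Y₂ , refl ,
  trans (pop-on-1-32 x y (Y ++ m ∷ M') out e) (trans popped (cong (_ ,_) (++-assoc out [ y ] Y₁)))
... | false = [] , y ∷ Y , refl , stop-on-1-32-free x y (Y ++ m ∷ M') out e

pop-above-new-minimum : ∀ {x m M'} Y out → x < m → Increasing (m ∷ M') → All (m <_) Y →
  popWhileP pat1-32 x (Y ++ m ∷ M') out ≡ (m ∷ M' , out ++ Y)
pop-above-new-minimum {x} {m} {M'} [] out x<m i _ =
  stop-on-1-32-free x m M' out (avoids⇒has1-32ᵇ≡false _ (increasing⇒avoids (x<m ∷ i)))
pop-above-new-minimum {x} {m} {M'} (y ∷ Y) out x<m i m<Y =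
  trans (pop-on-1-32 x y (Y ++ m ∷ M') out (cong (_∨ _) (hasDescentAboveᵇ-valley y Y x<m m<Y)))
        (trans (pop-above-new-minimum Y (out ++ [ y ]) x<m i (All.tail m<Y)) (cong (_ ,_) (++-assoc out [ y ] Y)))

push-without-pop : ∀ {x m M'} Y out → m ≤ x → Increasing (m ∷ M') → Decreasing Y → All (m <_) Y →
  All (_≤ x) Y → popWhileP pat1-32 x (Y ++ m ∷ M') out ≡ (Y ++ m ∷ M' , out)
push-without-pop {x} {m} {M'} [] out m≤x i d m<Y Y≤x =
  trans (stop-on-1-32-free x m M' out (push-on-valley-avoids [] d m<Y i m≤x [])) (cong (_ ,_) (++-identityʳ out))
push-without-pop {x} {m} {M'} (y ∷ Y) out m≤x i d m<Y Y≤x =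
  trans (stop-on-1-32-free x y (Y ++ m ∷ M') out (push-on-valley-avoids (y ∷ Y) d m<Y i m≤x (All.tail Y≤x)))
        (cong (_ ,_) (++-identityʳ out))

pop-until-above : ∀ {x m M'} y Y out → m ≤ x → Increasing (m ∷ M') → Decreasing (y ∷ Y) → All (m <_) (y ∷ Y) →
  x < y → ∃[ Y₁ ] ∃[ z ] ∃[ Y₂ ] y ∷ Y ≡ Y₁ ++ z ∷ Y₂ × x < z ×
          popWhileP pat1-32 x ((y ∷ Y) ++ m ∷ M') out ≡ (z ∷ Y₂ ++ m ∷ M' , out ++ Y₁)
pop-until-above {x} {m} {M'} y [] out m≤x i d m<Y x<y =
  [] , y , [] , refl , x<y , stop-on-1-32-free x y (m ∷ M') out (push-on-valley-avoids [ y ] d m<Y i m≤x [])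
pop-until-above {x} {m} {M'} y (y' ∷ Y) out m≤x i d@(y>y' ∷ d') m<Y x<y with <-≤-connex x y'
... | inj₁ x<y'
  with Y₁ , z , Y₂ , split , x<z , popped ← pop-until-above y' Y (out ++ [ y ]) m≤x i d' (All.tail m<Y) x<y' =
  y ∷ Y₁ , z , Y₂ , cong (y ∷_) split , x<z ,
  trans (pop-on-1-32 x y ((y' ∷ Y) ++ m ∷ M') out (cong (_∨ _) (cong (_∨ _) (descent-above x<y' y>y'))))
        (trans popped (cong (_ ,_) (++-assoc out [ y ] Y₁)))
... | inj₂ y'≤x = [] , y , y' ∷ Y , refl , x<y ,
  stop-on-1-32-free x y ((y' ∷ Y) ++ m ∷ M') out (push-on-valley-avoids (y ∷ y' ∷ Y) d m<Y i m≤x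
    (y'≤x ∷ All.map (λ z<y' → ≤-trans (<⇒≤ z<y') y'≤x) (decreasing⇒below-head d')))

-- While out ++ Y is decreasing, the configuration out, Y ++ m ∷ M' of s_{1-32} is summarised by
-- m, the last entry of out, and the top and bottom entries of Y; accepts follows the summary and
-- reports whether out ++ Y stays decreasing until the input is exhausted.
data Summary : Set where
  summary : ℕ → Maybe ℕ → Maybe (ℕ × ℕ) → Summary

belowLast : Maybe ℕ → ℕ → Bool
belowLast nothing x = true
belowLast (just u) x = x <ᵇ u

aboveTop : Maybe (ℕ × ℕ) → ℕ → Bool
aboveTop nothing x = true
aboveTop (just (t , b)) x = t <ᵇ x

pushEnds : Maybe (ℕ × ℕ) → ℕ → Maybe (ℕ × ℕ)
pushEnds nothing x = just (x , x)
pushEnds (just (t , b)) x = just (x , b)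

flushLast : Maybe ℕ → Maybe (ℕ × ℕ) → Maybe ℕ
flushLast u nothing = u
flushLast u (just (t , b)) = just b

accepts : Summary → List ℕ → Bool
accepts s [] = true
accepts (summary m u e) (x ∷ xs) =
  if x <ᵇ m then accepts (summary x (flushLast u e) nothing) xs
  else (belowLast u x ∧ aboveTop e x) ∧ accepts (summary m u (pushEnds e x)) xs

good : List ℕ → Bool
good [] = true
good (x ∷ xs) = accepts (summary x nothing nothing) xs

accepts-below : ∀ {m x} u e xs → x < m →
  accepts (summary m u e) (x ∷ xs) ≡ accepts (summary x (flushLast u e) nothing) xs
accepts-below u e xs x<m rewrite <⇒<ᵇ≡true x<m = refl

accepts-above : ∀ {m x} u e xs → m ≤ x →
  accepts (summary m u e) (x ∷ xs) ≡ (belowLast u x ∧ aboveTop e x) ∧ accepts (summary m u (pushEnds e x)) xs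
accepts-above u e xs m≤x rewrite ≥⇒<ᵇ≡false m≤x = refl

lastOr : ℕ → List ℕ → ℕ
lastOr x [] = x
lastOr x (y ∷ r) = lastOr y r

ends : List ℕ → Maybe (ℕ × ℕ)
ends [] = nothing
ends (y ∷ Y) = just (y , lastOr y Y)

lastOr-∈ : ∀ x A → lastOr x A ∈ x ∷ A
lastOr-∈ x [] = here refl
lastOr-∈ x (y ∷ A) = there (lastOr-∈ y A)

last-∷ : ∀ x A → last (x ∷ A) ≡ just (lastOr x A)
last-∷ x [] = refl
last-∷ x (y ∷ A) = last-∷ y A

last-++ : ∀ A B → last (A ++ B) ≡ flushLast (last A) (ends B)
last-++ A [] = cong last (++-identityʳ A)
last-++ [] (y ∷ B) = last-∷ y B
last-++ (a ∷ A) (y ∷ B) = trans (last-∷ a (A ++ y ∷ B)) (cong just (lastOr-++ a A))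
  where
  lastOr-++ : ∀ x A → lastOr x (A ++ y ∷ B) ≡ lastOr y B
  lastOr-++ x [] = refl
  lastOr-++ x (a ∷ A) = lastOr-++ a A

pushEnds-ends : ∀ Y x → pushEnds (ends Y) x ≡ ends (x ∷ Y)
pushEnds-ends [] x = refl
pushEnds-ends (y ∷ Y) x = refl

decreasing-insert : ∀ A B {x} → Decreasing (A ++ B) → belowLast (last A) x ≡ true → aboveTop (ends B) x ≡ true →
                    Decreasing (A ++ x ∷ B)
decreasing-insert [] [] d _ _ = [-]
decreasing-insert [] (b ∷ B) {x} d _ top = <ᵇ≡true⇒< b x top ∷ d
decreasing-insert (a ∷ []) B {x} d below top = <ᵇ≡true⇒< x a below ∷ decreasing-insert [] B (Linked.tail d) refl top
decreasing-insert (a ∷ a' ∷ A) B (a>a' ∷ d) below top = a>a' ∷ decreasing-insert (a' ∷ A) B d below top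

belowLast-false : ∀ A {x} → belowLast (last A) x ≡ false → ∃[ u ] u ∈ A × u ≤ x
belowLast-false (a ∷ A) {x} e rewrite last-∷ a A = lastOr a A , lastOr-∈ a A , <ᵇ≡false⇒≥ x (lastOr a A) e

aboveTop-true : ∀ Y {x} → Decreasing Y → aboveTop (ends Y) x ≡ true → All (_≤ x) Y
aboveTop-true [] _ _ = []
aboveTop-true (y ∷ Y) {x} d e = <⇒≤ y<x ∷ All.map (λ z<y → <⇒≤ (<-trans z<y y<x)) (decreasing⇒below-head d)
  where y<x = <ᵇ≡true⇒< y x e

aboveTop-false : ∀ Y {x} → aboveTop (ends Y) x ≡ false → ∃[ y ] ∃[ Y' ] Y ≡ y ∷ Y' × x ≤ y
aboveTop-false (y ∷ Y) {x} e = y , Y , refl , <ᵇ≡false⇒≥ y x e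

accepts-push : ∀ {m x} u e xs → m ≤ x → belowLast u x ≡ true → aboveTop e x ≡ true →
               accepts (summary m u e) (x ∷ xs) ≡ accepts (summary m u (pushEnds e x)) xs
accepts-push {m} {x} u e xs m≤x below top =
  trans (accepts-above u e xs m≤x) (cong₂ (λ a b → (a ∧ b) ∧ accepts (summary m u (pushEnds e x)) xs) below top)

accepts-reject : ∀ {m x} u e xs → m ≤ x → aboveTop e x ≡ false → accepts (summary m u e) (x ∷ xs) ≡ false
accepts-reject {m} {x} u e xs m≤x top =
  trans (accepts-above u e xs m≤x)
        (cong (_∧ accepts (summary m u (pushEnds e x)) xs) (trans (cong (belowLast u x ∧_) top) (∧-zeroʳ _)))

accepts-forget-last : ∀ {v} xs m e → All (_< v) xs → accepts (summary m (just v) e) xs ≡ accepts (summary m nothing e) xs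
accepts-forget-last [] m e _ = refl
accepts-forget-last {v} (x ∷ xs) m e (x<v ∷ xs<v) with <-≤-connex x m
... | inj₁ x<m = trans (accepts-below (just v) e xs x<m) (trans (flush e) (sym (accepts-below nothing e xs x<m)))
  where
  flush : ∀ e → accepts (summary x (flushLast (just v) e) nothing) xs ≡ accepts (summary x (flushLast nothing e) nothing) xs
  flush nothing = accepts-forget-last xs x nothing xs<v
  flush (just _) = refl
... | inj₂ m≤x = trans (accepts-above (just v) e xs m≤x)
  (trans (cong₂ (λ a b → (a ∧ aboveTop e x) ∧ b) (<⇒<ᵇ≡true x<v) (accepts-forget-last xs m (pushEnds e x) xs<v))
         (sym (accepts-above nothing e xs m≤x)))

good-descent : ∀ {a b} r → b < a → good (a ∷ b ∷ r) ≡ good (b ∷ r)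
good-descent r b<a = accepts-below nothing nothing r b<a

good-∷-max : ∀ {v} τ → All (_< v) τ → good (v ∷ τ) ≡ good τ
good-∷-max [] _ = refl
good-∷-max (a ∷ τ) (a<v ∷ _) = good-descent τ a<v

-- The output of s_{1-32}

Verdict : Bool → List ℕ → Set
Verdict true = Decreasing
Verdict false = HasAscent

record OutputShape (w : List ℕ) (b : Bool) : Set where
  constructor shape
  field
    prefix : List ℕ
    minimum : ℕ
    rise : List ℕ
    split : w ≡ prefix ++ minimum ∷ rise
    increasing : Increasing (minimum ∷ rise)
    above : All (minimum <_) prefix
    verdict : Verdict b prefix

unique-prefix≢ : ∀ out st {x rest v} → Unique (out ++ st ++ x ∷ rest) → v ∈ out ++ st → v ≢ x
unique-prefix≢ out st u v∈ refl = unique⇒∉-prefix {ℕ} (out ++ st) (subst Unique (sym (++-assoc out st _)) u) v∈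

above-stack-minimum : ∀ out Y {m M' x rest} → Unique (out ++ (Y ++ m ∷ M') ++ x ∷ rest) → m ≤ x → m < x
above-stack-minimum out Y {m} {M'} u m≤x =
  ≤∧≢⇒< m≤x (unique-prefix≢ out (Y ++ m ∷ M') u (∈-++⁺ʳ out (∈-++⁺ʳ Y (here refl))))

shape-after-ascent : ∀ rest out Y {m M'} → Increasing (m ∷ M') → All (m <_) Y → All (m <_) out →
  HasAscent (out ++ Y) → Unique (out ++ (Y ++ m ∷ M') ++ rest) →
  OutputShape (runP pat1-32 (Y ++ m ∷ M') out rest) false
shape-after-ascent [] out Y i m<Y m<out h u = shape (out ++ Y) _ _ (sym (++-assoc out Y _)) i (All.++⁺ m<out m<Y) h
shape-after-ascent (x ∷ rest) out Y {m} {M'} i m<Y m<out h u with <-≤-connex x m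
... | inj₁ x<m =
  subst (λ w → OutputShape w false) (sym (runP-∷ pat1-32 x (Y ++ m ∷ M') out rest popped))
    (shape-after-ascent rest (out ++ Y) [] (x<m ∷ i) []
      (All.++⁺ (All.map (<-trans x<m) m<out) (All.map (<-trans x<m) m<Y))
      (subst HasAscent (sym (++-identityʳ _)) h) (unique-step pat1-32 x (Y ++ m ∷ M') out rest popped u))
  where popped = pop-above-new-minimum Y out x<m i m<Y
... | inj₂ m≤x with Y₁ , Y₂ , refl , popped ← pop-keeps-minimum (push-on-valley-avoids [] [] [] i m≤x []) Y out =
  subst (λ w → OutputShape w false) (sym (runP-∷ pat1-32 x ((Y₁ ++ Y₂) ++ m ∷ M') out rest popped))
    (shape-after-ascent rest (out ++ Y₁) (x ∷ Y₂) i
      (above-stack-minimum out Y u m≤x ∷ All.++⁻ʳ Y₁ m<Y) (All.++⁺ m<out (All.++⁻ˡ Y₁ m<Y))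
      (hasAscent-insert (out ++ Y₁) x (subst HasAscent (sym (++-assoc out Y₁ Y₂)) h))
      (unique-step pat1-32 x ((Y₁ ++ Y₂) ++ m ∷ M') out rest popped u))

shape-after-exceeding-last : ∀ x rest out Y {m M'} → Increasing (m ∷ M') → All (m <_) Y → All (m <_) out →
  Unique (out ++ (Y ++ m ∷ M') ++ x ∷ rest) → m ≤ x → belowLast (last out) x ≡ false →
  OutputShape (runP pat1-32 (Y ++ m ∷ M') out (x ∷ rest)) false
shape-after-exceeding-last x rest out Y {m} {M'} i m<Y m<out u m≤x above-last
  with Y₁ , Y₂ , refl , popped ← pop-keeps-minimum (push-on-valley-avoids [] [] [] i m≤x []) Y out
  with v , v∈out , v≤x ← belowLast-false out above-last =
  subst (λ w → OutputShape w false) (sym (runP-∷ pat1-32 x ((Y₁ ++ Y₂) ++ m ∷ M') out rest popped))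
    (shape-after-ascent rest (out ++ Y₁) (x ∷ Y₂) i
      (above-stack-minimum out (Y₁ ++ Y₂) u m≤x ∷ All.++⁻ʳ Y₁ m<Y) (All.++⁺ m<out (All.++⁻ˡ Y₁ m<Y))
      (hasAscent-insert-above (out ++ Y₁) (∈-++⁺ˡ v∈out)
        (≤∧≢⇒< v≤x (unique-prefix≢ out ((Y₁ ++ Y₂) ++ m ∷ M') u (∈-++⁺ˡ v∈out))))
      (unique-step pat1-32 x ((Y₁ ++ Y₂) ++ m ∷ M') out rest popped u))

shape-after-falling-below-top : ∀ x rest out Y {m M'} → Increasing (m ∷ M') → All (m <_) Y → All (m <_) out →
  Decreasing (out ++ Y) → Unique (out ++ (Y ++ m ∷ M') ++ x ∷ rest) → m ≤ x → aboveTop (ends Y) x ≡ false →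
  OutputShape (runP pat1-32 (Y ++ m ∷ M') out (x ∷ rest)) false
shape-after-falling-below-top x rest out Y {m} {M'} i m<Y m<out d u m≤x below-top
  with y , Y' , refl , x≤y ← aboveTop-false Y below-top
  with Y₁ , z , Y₂ , split , x<z , popped ← pop-until-above y Y' out m≤x i (decreasing-++⁻ʳ out d) m<Y
         (≤∧≢⇒< x≤y (λ x≡y → unique-prefix≢ out ((y ∷ Y') ++ m ∷ M') u (∈-++⁺ʳ out (here refl)) (sym x≡y))) =
  subst (λ w → OutputShape w false) (sym (runP-∷ pat1-32 x ((y ∷ Y') ++ m ∷ M') out rest popped))
    (shape-after-ascent rest (out ++ Y₁) (x ∷ z ∷ Y₂) i
      (above-stack-minimum out (y ∷ Y') u m≤x ∷ All.++⁻ʳ Y₁ m<Y') (All.++⁺ m<out (All.++⁻ˡ Y₁ m<Y'))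
      (hasAscent-++⁺ʳ (out ++ Y₁) (here (here refl) x<z))
      (unique-step pat1-32 x ((y ∷ Y') ++ m ∷ M') out rest popped u))
  where m<Y' = subst (All (m <_)) split m<Y

shape-while-decreasing : ∀ rest out Y {m M'} → Increasing (m ∷ M') → All (m <_) Y → All (m <_) out →
  Decreasing (out ++ Y) → Unique (out ++ (Y ++ m ∷ M') ++ rest) →
  OutputShape (runP pat1-32 (Y ++ m ∷ M') out rest) (accepts (summary m (last out) (ends Y)) rest)
shape-while-decreasing [] out Y i m<Y m<out d u =
  shape (out ++ Y) _ _ (sym (++-assoc out Y _)) i (All.++⁺ m<out m<Y) d
shape-while-decreasing (x ∷ rest) out Y {m} {M'} i m<Y m<out d u with <-≤-connex x m
... | inj₁ x<m =
  subst₂ OutputShape (sym (runP-∷ pat1-32 x (Y ++ m ∷ M') out rest popped))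
    (sym (trans (accepts-below (last out) (ends Y) rest x<m)
                (cong (λ l → accepts (summary x l nothing) rest) (sym (last-++ out Y)))))
    (shape-while-decreasing rest (out ++ Y) [] (x<m ∷ i) []
      (All.++⁺ (All.map (<-trans x<m) m<out) (All.map (<-trans x<m) m<Y))
      (subst Decreasing (sym (++-identityʳ _)) d) (unique-step pat1-32 x (Y ++ m ∷ M') out rest popped u))
  where popped = pop-above-new-minimum Y out x<m i m<Y
... | inj₂ m≤x rewrite accepts-above (last out) (ends Y) rest m≤x
  with belowLast (last out) x in below | aboveTop (ends Y) x in top
...   | false | _ = shape-after-exceeding-last x rest out Y i m<Y m<out u m≤x below
...   | true | false = shape-after-falling-below-top x rest out Y i m<Y m<out d u m≤x top
...   | true | true =
  subst₂ OutputShape (sym (runP-∷ pat1-32 x (Y ++ m ∷ M') out rest popped))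
    (sym (cong (λ e → accepts (summary m (last out) e) rest) (pushEnds-ends Y x)))
    (shape-while-decreasing rest out (x ∷ Y) i (above-stack-minimum out Y u m≤x ∷ m<Y) m<out
      (decreasing-insert out Y d below top) (unique-step pat1-32 x (Y ++ m ∷ M') out rest popped u))
  where
  dY = decreasing-++⁻ʳ out d
  popped = push-without-pop Y out m≤x i dY m<Y (aboveTop-true Y dY top)

stackMap-shape : ∀ x xs → Unique (x ∷ xs) → OutputShape (stackMap pat1-32 (x ∷ xs)) (good (x ∷ xs))
stackMap-shape x xs u = shape-while-decreasing xs [] [] [-] [] [] [] u

-- West's stack-sorting map

popSmaller-split : ∀ x st out → ∃[ s₁ ] ∃[ s₂ ] st ≡ s₁ ++ s₂ × popSmaller x st out ≡ (s₂ , out ++ s₁) ×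
                   All (_< x) s₁ × Connected _≤_ (just x) (head s₂)
popSmaller-split x [] out = [] , [] , refl , cong ([] ,_) (sym (++-identityʳ out)) , [] , just-nothing
popSmaller-split x (y ∷ st) out with y <ᵇ x | <ᵇ-reflects-< y x
... | true | ofʸ y<x with s₁ , s₂ , refl , popped , s₁<x , x≤s₂ ← popSmaller-split x st (out ++ [ y ]) =
  y ∷ s₁ , s₂ , refl , trans popped (cong (s₂ ,_) (++-assoc out [ y ] s₁)) , y<x ∷ s₁<x , x≤s₂
... | false | ofⁿ y≮x = [] , y ∷ st , refl , cong (y ∷ st ,_) (sym (++-identityʳ out)) , [] , just (≮⇒≥ y≮x)

popSmaller-none : ∀ {x} st out → Connected _≤_ (just x) (head st) → popSmaller x st out ≡ (st , out)
popSmaller-none [] out _ = refl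
popSmaller-none (y ∷ st) out (just x≤y) rewrite ≥⇒<ᵇ≡false x≤y = refl

runW-∷ : ∀ x st out xs {st' out'} → popSmaller x st out ≡ (st' , out') → runW st out (x ∷ xs) ≡ runW (x ∷ st') out' xs
runW-∷ x st out xs e rewrite e = refl

runW-extends : ∀ st out xs → ∃[ r ] runW st out xs ≡ out ++ r
runW-extends st out [] = st , refl
runW-extends st out (x ∷ xs) with s₁ , s₂ , refl , popped , _ ← popSmaller-split x st out
  with r , e ← runW-extends (x ∷ s₂) (out ++ s₁) xs =
  s₁ ++ r , trans (runW-∷ x (s₁ ++ s₂) out xs popped) (trans e (++-assoc out s₁ r))

runW-↭ : ∀ st out xs → runW st out xs ↭ out ++ st ++ xs
runW-↭ st out [] = ↭-reflexive (cong (out ++_) (sym (++-identityʳ st)))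
runW-↭ st out (x ∷ xs) with s₁ , s₂ , refl , popped , _ ← popSmaller-split x st out =
  subst (_↭ out ++ (s₁ ++ s₂) ++ x ∷ xs) (sym (runW-∷ x (s₁ ++ s₂) out xs popped))
    (↭-trans (runW-↭ (x ∷ s₂) (out ++ s₁) xs)
      (↭-trans (++⁺ˡ (out ++ s₁) (↭-sym (shift x s₂ xs))) (↭-reflexive moved)))
  where
  moved : (out ++ s₁) ++ s₂ ++ x ∷ xs ≡ out ++ (s₁ ++ s₂) ++ x ∷ xs
  moved = trans (++-assoc out s₁ _) (cong (out ++_) (sym (++-assoc s₁ s₂ _)))

sorted-∷ : ∀ {x st} → Connected _≤_ (just x) (head st) → Sorted st → Sorted (x ∷ st)
sorted-∷ {st = []} _ _ = [-]
sorted-∷ {st = y ∷ st} (just x≤y) s = x≤y ∷ s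

sorted-insert : ∀ A B {x} → Sorted (A ++ B) → All (_≤ x) A → Connected _≤_ (just x) (head B) → Sorted (A ++ x ∷ B)
sorted-insert [] B s _ c = sorted-∷ c s
sorted-insert (a ∷ []) B s (a≤x ∷ _) c = a≤x ∷ sorted-insert [] B (Linked.tail s) [] c
sorted-insert (a ∷ a' ∷ A) B (a≤a' ∷ s) (_ ∷ A≤x) c = a≤a' ∷ sorted-insert (a' ∷ A) B s A≤x c

runW-sorted : ∀ ms st out → Sorted ms → Sorted (out ++ st) → All (λ o → All (o ≤_) ms) out → Sorted (runW st out ms)
runW-sorted [] st out _ s _ = s
runW-sorted (x ∷ ms) st out sm s out≤ with s₁ , s₂ , refl , popped , s₁<x , x≤s₂ ← popSmaller-split x st out =
  subst Sorted (sym (runW-∷ x (s₁ ++ s₂) out ms popped))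
    (runW-sorted ms (x ∷ s₂) (out ++ s₁) (Linked.tail sm)
      (sorted-insert (out ++ s₁) s₂ (subst Sorted (sym (++-assoc out s₁ s₂)) s)
        (All.++⁺ (All.map All.head out≤) (All.map <⇒≤ s₁<x)) x≤s₂)
      (All.++⁺ (All.map All.tail out≤)
               (All.map (λ z<x → All.map (≤-trans (<⇒≤ z<x)) (sorted⇒above-head sm)) s₁<x)))

second-below-head : ∀ {d D} → Decreasing (d ∷ D) → Connected _≤_ (head D) (just d)
second-below-head [-] = nothing-just
second-below-head (d>d' ∷ _) = just (<⇒≤ d>d')

runW-push-decreasing : ∀ D st ms → Decreasing D → Sorted st → Connected _≤_ (head D) (head st) →
                       ∃[ st' ] runW st [] (D ++ ms) ≡ runW st' [] ms × Sorted st'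
runW-push-decreasing [] st ms _ s _ = st , refl , s
runW-push-decreasing (d ∷ D) st ms dD s d≤st
  with st' , e , s' ← runW-push-decreasing D (d ∷ st) ms (Linked.tail dD) (sorted-∷ d≤st s) (second-below-head dD) =
  st' , trans (runW-∷ d st [] (D ++ ms) (popSmaller-none st [] d≤st)) e , s'

connected-nothing : ∀ D → Connected _≤_ (head D) nothing
connected-nothing [] = nothing
connected-nothing (_ ∷ _) = just-nothing

westSort-valley-sorted : ∀ D ms → Decreasing D → Sorted ms → Sorted (westSort (D ++ ms))
westSort-valley-sorted D ms dD sm with st' , e , s ← runW-push-decreasing D [] ms dD [] (connected-nothing D) =
  subst Sorted (sym e) (runW-sorted ms st' [] sm s [])

runW-first-output : ∀ {P : ℕ → Set} st A {d B} xs → All P (A ++ d ∷ B) →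
                    ∃[ h ] ∃[ t ] runW st (A ++ d ∷ B) xs ≡ h ∷ t × P h
runW-first-output st [] xs (pd ∷ _) with r , e ← runW-extends st (_ ∷ _) xs = _ , _ , e , pd
runW-first-output st (a ∷ A) xs (pa ∷ _) with r , e ← runW-extends st (a ∷ A ++ _ ∷ _) xs = a , _ , e , pa

-- An adjacent ascent in D forces a pop before ms is read.
runW-ascent-outputs-early : ∀ {P : ℕ → Set} D st out ms → AdjacentAscent D → All P D → All P st → All P out →
                            ∃[ h ] ∃[ t ] runW st out (D ++ ms) ≡ h ∷ t × P h
runW-ascent-outputs-early D st (o ∷ out) ms _ _ _ pout = runW-first-output st [] (D ++ ms) pout
runW-ascent-outputs-early (d ∷ e ∷ D) st [] ms (here d<e) (pd ∷ pe ∷ _) pst []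
  with s₁ , s₂ , refl , popped₁ , _ ← popSmaller-split d st []
  with u₁ , u₂ , refl , popped₂ , _ ← popSmaller-split e s₂ (s₁ ++ [ d ])
  with h , t , first , ph ← runW-first-output (e ∷ u₂) s₁ (D ++ ms)
                              (All.++⁺ (All.++⁻ˡ s₁ pst) (pd ∷ All.++⁻ˡ u₁ (All.++⁻ʳ s₁ pst))) =
  h , t ,
  trans (runW-∷ d (s₁ ++ u₁ ++ u₂) [] (e ∷ D ++ ms) popped₁)
    (trans (runW-∷ e (d ∷ u₁ ++ u₂) s₁ (D ++ ms) (trans pop-d popped₂))
      (trans (cong (λ o → runW (e ∷ u₂) o (D ++ ms)) (++-assoc s₁ [ d ] u₁)) first)) ,
  ph
  where
  pop-d : popSmaller e (d ∷ u₁ ++ u₂) s₁ ≡ popSmaller e (u₁ ++ u₂) (s₁ ++ [ d ])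
  pop-d rewrite <⇒<ᵇ≡true d<e = refl
runW-ascent-outputs-early (d ∷ D) st [] ms (there a) (pd ∷ pD) pst []
  with s₁ , s₂ , refl , popped , _ ← popSmaller-split d st []
  with h , t , e , ph ← runW-ascent-outputs-early D (d ∷ s₂) s₁ ms a pD
                           (pd ∷ All.++⁻ʳ s₁ pst) (All.++⁻ˡ s₁ pst) =
  h , t , trans (runW-∷ d (s₁ ++ s₂) [] (D ++ ms) popped) e , ph

sorted-↭⇒≡ : ∀ {xs ys} → Sorted xs → Sorted ys → xs ↭ ys → xs ≡ ys
sorted-↭⇒≡ sx sy p = Pointwise-≡⇒≡ (↗↭↗⇒≋ ≤-totalOrder sx sy (↭⇒↭ₛ p))

increasing⇒sorted : ∀ {xs} → Increasing xs → Sorted xs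
increasing⇒sorted = Linked.map <⇒≤

idPerm-increasing : ∀ n → Increasing (idPerm n)
idPerm-increasing n =
  subst Increasing (sym (map-applyUpTo (λ i → i) suc n)) (Linkedₚ.applyUpTo⁺₂ suc n (λ _ → ≤-refl))

idPerm-unique : ∀ n → Unique (idPerm n)
idPerm-unique n = Uniqueₚ.map⁺ suc-injective (Uniqueₚ.upTo⁺ n)

∈-idPerm⁻ : ∀ {n z} → z ∈ idPerm n → 1 ≤ z × z ≤ n
∈-idPerm⁻ z∈ with y , y∈ , refl ← ∈-map⁻ suc z∈ = s≤s z≤n , ∈-upTo⁻ y∈

sortable⇔good : ∀ n τ → τ ↭ idPerm (suc n) → (westSort (stackMap pat1-32 τ) ≡ idPerm (suc n)) ⇔ (good τ ≡ true)
sortable⇔good n [] p = contradiction (↭-sym p) ¬x∷xs↭[]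
sortable⇔good n (x ∷ xs) p
  with good (x ∷ xs) | stackMap-shape x xs (unique-resp-↭ (↭-sym p) (idPerm-unique (suc n)))
... | true | shape D m M' split i _ d =
  mk⇔ (λ _ → refl) (λ _ → sorted-↭⇒≡ sortedOut (increasing⇒sorted (idPerm-increasing (suc n))) permOut)
  where
  sortedOut : Sorted (westSort (stackMap pat1-32 (x ∷ xs)))
  sortedOut = subst (λ w → Sorted (westSort w)) (sym split) (westSort-valley-sorted D (m ∷ M') d (increasing⇒sorted i))
  permOut : westSort (stackMap pat1-32 (x ∷ xs)) ↭ idPerm (suc n)
  permOut = ↭-trans (runW-↭ [] [] _) (↭-trans (runP-↭ pat1-32 [] [] (x ∷ xs)) p)
... | false | shape D m M' split _ m<D h = mk⇔ starts-with-1 (λ ())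
  where
  starts-with-1 : westSort (stackMap pat1-32 (x ∷ xs)) ≡ idPerm (suc n) → false ≡ true
  starts-with-1 sorts
    with first , _ , e , m<first ← runW-ascent-outputs-early D [] [] (m ∷ M') (hasAscent⇒adjacentAscent h) m<D [] [] =
    contradiction (subst (m <_) first≡1 m<first) (≤⇒≯ (proj₁ (∈-idPerm⁻ m∈)))
    where
    first≡1 : first ≡ 1
    first≡1 = ∷-injectiveˡ (trans (sym e) (trans (cong westSort (sym split)) sorts))
    m∈ : m ∈ idPerm (suc n)
    m∈ = ∈-resp-↭ (↭-trans (runP-↭ pat1-32 [] [] (x ∷ xs)) p) (subst (m ∈_) (sym split) (∈-++⁺ʳ D (here refl)))

-- Inserting a new maximum

descentRun : List ℕ → ℕ
descentRun [] = 0
descentRun (a ∷ []) = 1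
descentRun (a ∷ b ∷ r) = if b <ᵇ a then suc (descentRun (b ∷ r)) else 1

descentRun-< : ∀ {a b} r → b < a → descentRun (a ∷ b ∷ r) ≡ suc (descentRun (b ∷ r))
descentRun-< r b<a rewrite <⇒<ᵇ≡true b<a = refl

descentRun-≥ : ∀ {a b} r → a ≤ b → descentRun (a ∷ b ∷ r) ≡ 1
descentRun-≥ r a≤b rewrite ≥⇒<ᵇ≡false a≤b = refl

descentRun-positive : ∀ a r → 1 ≤ descentRun (a ∷ r)
descentRun-positive a [] = ≤-refl
descentRun-positive a (b ∷ r) with <-≤-connex b a
... | inj₁ b<a rewrite descentRun-< r b<a = s≤s z≤n
... | inj₂ a≤b rewrite descentRun-≥ r a≤b = ≤-refl

descentRun-≤-length : ∀ τ → descentRun τ ≤ length τ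
descentRun-≤-length [] = z≤n
descentRun-≤-length (a ∷ []) = ≤-refl
descentRun-≤-length (a ∷ b ∷ r) = step (<-≤-connex b a) (descentRun-≤-length (b ∷ r))
  where
  step : b < a ⊎ a ≤ b → descentRun (b ∷ r) ≤ length (b ∷ r) → descentRun (a ∷ b ∷ r) ≤ length (a ∷ b ∷ r)
  step (inj₁ b<a) run≤ = subst (_≤ length (a ∷ b ∷ r)) (sym (descentRun-< r b<a)) (s≤s run≤)
  step (inj₂ a≤b) _ = subst (_≤ length (a ∷ b ∷ r)) (sym (descentRun-≥ r a≤b)) (s≤s z≤n)

insertAfterRise : ℕ → ℕ → List ℕ → List ℕ
insertAfterRise v p [] = [ v ]
insertAfterRise v p (b ∷ r) = if p <ᵇ b then b ∷ insertAfterRise v b r else v ∷ b ∷ r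

-- insertAt v 0 τ = v ∷ τ; for j ≥ 1, insertAt v j τ keeps τ₁ … τⱼ and puts v after the
-- increasing run that starts at τⱼ.
insertAt : ℕ → ℕ → List ℕ → List ℕ
insertAt v zero τ = v ∷ τ
insertAt v (suc j) [] = [ v ]
insertAt v (suc zero) (a ∷ r) = a ∷ insertAfterRise v a r
insertAt v (suc (suc j)) (a ∷ r) = a ∷ insertAt v (suc j) r

insertAfterRise-< : ∀ v {p b} r → p < b → insertAfterRise v p (b ∷ r) ≡ b ∷ insertAfterRise v b r
insertAfterRise-< v r p<b rewrite <⇒<ᵇ≡true p<b = refl

insertAfterRise-≥ : ∀ v {p b} r → b ≤ p → insertAfterRise v p (b ∷ r) ≡ v ∷ b ∷ r
insertAfterRise-≥ v r b≤p rewrite ≥⇒<ᵇ≡false b≤p = refl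

insertAfterRise-↭ : ∀ v p r → insertAfterRise v p r ↭ v ∷ r
insertAfterRise-↭ v p [] = ↭-refl
insertAfterRise-↭ v p (b ∷ r) with <-≤-connex p b
... | inj₁ p<b rewrite insertAfterRise-< v r p<b = ↭-trans (↭-prep b (insertAfterRise-↭ v b r)) (↭-swap b v ↭-refl)
... | inj₂ b≤p rewrite insertAfterRise-≥ v r b≤p = ↭-refl

insertAt-↭ : ∀ v j τ → insertAt v j τ ↭ v ∷ τ
insertAt-↭ v zero τ = ↭-refl
insertAt-↭ v (suc j) [] = ↭-refl
insertAt-↭ v (suc zero) (a ∷ r) = ↭-trans (↭-prep a (insertAfterRise-↭ v a r)) (↭-swap a v ↭-refl)
insertAt-↭ v (suc (suc j)) (a ∷ r) = ↭-trans (↭-prep a (insertAt-↭ v (suc j) r)) (↭-swap a v ↭-refl)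

insertAt-suc-∷ : ∀ v j b r → ∃[ X ] insertAt v (suc j) (b ∷ r) ≡ b ∷ X
insertAt-suc-∷ v zero b r = insertAfterRise v b r , refl
insertAt-suc-∷ v (suc j) b r = insertAt v (suc j) r , refl

descentRun-insertAfterRise : ∀ {v a} r → a < v → descentRun (a ∷ insertAfterRise v a r) ≡ 1
descentRun-insertAfterRise [] a<v = descentRun-≥ [] (<⇒≤ a<v)
descentRun-insertAfterRise {v} {a} (b ∷ r) a<v with <-≤-connex a b
... | inj₁ a<b rewrite insertAfterRise-< v r a<b = descentRun-≥ (insertAfterRise v b r) (<⇒≤ a<b)
... | inj₂ b≤a rewrite insertAfterRise-≥ v r b≤a = descentRun-≥ (b ∷ r) (<⇒≤ a<v)

-- p is the entry read last: the top of Y, or the minimum m itself when Y is empty.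
LastRead : Maybe (ℕ × ℕ) → ℕ → ℕ → Set
LastRead e m p = (e ≡ nothing × p ≡ m) ⊎ ∃[ q ] e ≡ just (p , q)

aboveTop-lastRead : ∀ {e m p x} → LastRead e m p → p < x → aboveTop e x ≡ true
aboveTop-lastRead (inj₁ (refl , _)) _ = refl
aboveTop-lastRead (inj₂ (q , refl)) p<x = <⇒<ᵇ≡true p<x

lastRead-push : ∀ {m} e x → LastRead (pushEnds e x) m x
lastRead-push nothing x = inj₂ (x , refl)
lastRead-push (just (t , q)) x = inj₂ (q , refl)

falling-is-new-minimum : ∀ {e m p b} r → LastRead e m p → b < p → accepts (summary m nothing e) (b ∷ r) ≡ true → b < m
falling-is-new-minimum r (inj₁ (_ , refl)) b<p _ = b<p
falling-is-new-minimum {e} {m} {p} {b} r (inj₂ (q , refl)) b<p accepted with <-≤-connex b m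
... | inj₁ b<m = b<m
... | inj₂ m≤b = contradiction (trans (sym accepted) (accepts-reject nothing e r m≤b (≥⇒<ᵇ≡false (<⇒≤ b<p)))) λ ()

flush-pushed-max : ∀ {v b} e r → All (_< v) r →
  accepts (summary b (flushLast nothing (pushEnds e v)) nothing) r ≡ accepts (summary b (flushLast nothing e) nothing) r
flush-pushed-max {b = b} nothing r r<v = accepts-forget-last r b nothing r<v
flush-pushed-max (just _) r r<v = refl

accepts-insertAfterRise : ∀ {v m e p} r → LastRead e m p → m ≤ p → p < v → All (_< v) r → Unique (p ∷ r) →
  accepts (summary m nothing e) r ≡ true → accepts (summary m nothing e) (insertAfterRise v p r) ≡ true
accepts-insertAfterRise {e = e} [] last m≤p p<v _ _ _ =
  accepts-push nothing e [] (≤-trans m≤p (<⇒≤ p<v)) refl (aboveTop-lastRead last p<v)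
accepts-insertAfterRise {v} {m} {e} {p} (b ∷ r) last m≤p p<v (b<v ∷ r<v) ((p≢b ∷ _) ∷ u) accepted with <-≤-connex p b
... | inj₁ p<b = begin
  accepts (summary m nothing e) (insertAfterRise v p (b ∷ r))     ≡⟨ cong (accepts _) (insertAfterRise-< v r p<b) ⟩
  accepts (summary m nothing e) (b ∷ insertAfterRise v b r)       ≡⟨ push (insertAfterRise v b r) ⟩
  accepts (summary m nothing (pushEnds e b)) (insertAfterRise v b r)
    ≡⟨ accepts-insertAfterRise r (lastRead-push e b) m≤b b<v r<v u (trans (sym (push r)) accepted) ⟩
  true ∎
  where
  open ≡-Reasoning
  m≤b = ≤-trans m≤p (<⇒≤ p<b)
  push : ∀ xs → accepts (summary m nothing e) (b ∷ xs) ≡ accepts (summary m nothing (pushEnds e b)) xs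
  push xs = accepts-push nothing e xs m≤b refl (aboveTop-lastRead last p<b)
... | inj₂ b≤p = begin
  accepts (summary m nothing e) (insertAfterRise v p (b ∷ r))             ≡⟨ cong (accepts _) (insertAfterRise-≥ v r b≤p) ⟩
  accepts (summary m nothing e) (v ∷ b ∷ r)
    ≡⟨ accepts-push nothing e (b ∷ r) (≤-trans m≤p (<⇒≤ p<v)) refl (aboveTop-lastRead last p<v) ⟩
  accepts (summary m nothing (pushEnds e v)) (b ∷ r)                      ≡⟨ accepts-below nothing (pushEnds e v) r b<m ⟩
  accepts (summary b (flushLast nothing (pushEnds e v)) nothing) r        ≡⟨ flush-pushed-max e r r<v ⟩
  accepts (summary b (flushLast nothing e) nothing) r                     ≡⟨ accepts-below nothing e r b<m ⟨
  accepts (summary m nothing e) (b ∷ r)                                   ≡⟨ accepted ⟩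
  true ∎
  where
  open ≡-Reasoning
  b<m = falling-is-new-minimum r last (≤∧≢⇒< b≤p (≢-sym p≢b)) accepted

insertAt-good : ∀ {v} j τ → Unique τ → All (_< v) τ → good τ ≡ true → suc j ≤ descentRun τ →
                good (insertAt v (suc j) τ) ≡ true × descentRun (insertAt v (suc j) τ) ≡ suc j
insertAt-good zero (x ∷ r) u (x<v ∷ r<v) g _ =
  accepts-insertAfterRise r (inj₁ (refl , refl)) ≤-refl x<v r<v u g , descentRun-insertAfterRise r x<v
insertAt-good (suc j) (x ∷ []) _ _ _ (s≤s ())
insertAt-good {v} (suc j) (x ∷ b ∷ r) (_ ∷ u) (_ ∷ r<v) g j≤run with <-≤-connex b x
... | inj₂ x≤b = contradiction (subst (suc (suc j) ≤_) (descentRun-≥ r x≤b) j≤run) λ { (s≤s ()) }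
... | inj₁ b<x with X , e ← insertAt-suc-∷ v j b r
  with good′ , run′ ← insertAt-good j (b ∷ r) u r<v (trans (sym (good-descent r b<x)) g)
                        (s≤s⁻¹ (subst (suc (suc j) ≤_) (descentRun-< r b<x) j≤run))
  rewrite e =
  trans (good-descent X b<x) good′ , trans (descentRun-< X b<x) (cong suc run′)

cons-max-good : ∀ {v} τ → All (_< v) τ → good τ ≡ true → good (v ∷ τ) ≡ true × descentRun (v ∷ τ) ≡ suc (descentRun τ)
cons-max-good [] _ g = refl , refl
cons-max-good (a ∷ τ) τ<v@(a<v ∷ _) g = trans (good-∷-max (a ∷ τ) τ<v) g , descentRun-< τ a<v

strictly-below : ∀ {v} xs → All (_≤ v) xs → v ∉ xs → All (_< v) xs
strictly-below [] _ _ = []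
strictly-below (x ∷ xs) (x≤v ∷ xs≤v) v∉ =
  ≤∧≢⇒< x≤v (λ x≡v → v∉ (here (sym x≡v))) ∷ strictly-below xs xs≤v (λ v∈ → v∉ (there v∈))

BottomBelow : Maybe (ℕ × ℕ) → ℕ → Set
BottomBelow nothing v = ⊤
BottomBelow (just (t , q)) v = q < v

-- The last output entry stays below v, so v can never be pushed.
late-maximum-rejected : ∀ {v} pre post m u e → All (_< v) pre → u < v → m < v → BottomBelow e v →
  accepts (summary m (just u) e) (pre ++ v ∷ post) ≡ false
late-maximum-rejected {v} [] post m u e _ u<v m<v _ =
  trans (accepts-above (just u) e post (<⇒≤ m<v))
        (cong (λ b → (b ∧ aboveTop e v) ∧ accepts (summary m (just u) (pushEnds e v)) post) (≥⇒<ᵇ≡false (<⇒≤ u<v)))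
late-maximum-rejected {v} (x ∷ pre) post m u e (x<v ∷ pre<v) u<v m<v bottom<v with <-≤-connex x m
... | inj₁ x<m = trans (accepts-below (just u) e (pre ++ v ∷ post) x<m) (flushed e bottom<v)
  where
  flushed : ∀ e → BottomBelow e v → accepts (summary x (flushLast (just u) e) nothing) (pre ++ v ∷ post) ≡ false
  flushed nothing _ = late-maximum-rejected pre post x u nothing pre<v u<v x<v tt
  flushed (just (t , q)) q<v = late-maximum-rejected pre post x q nothing pre<v q<v x<v tt
... | inj₂ m≤x rewrite accepts-above (just u) e (pre ++ v ∷ post) m≤x with belowLast (just u) x ∧ aboveTop e x
...   | false = refl
...   | true = late-maximum-rejected pre post m u (pushEnds e x) pre<v u<v m<v (pushed e bottom<v)
  where
  pushed : ∀ e → BottomBelow e v → BottomBelow (pushEnds e x) v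
  pushed nothing _ = x<v
  pushed (just _) q<v = q<v

accepts-max-pushed : ∀ {v m e p} r → LastRead e m p → m ≤ p → p < v → All (_< v) r →
  accepts (summary m nothing e) (v ∷ r) ≡ true → insertAfterRise v p r ≡ v ∷ r × accepts (summary m nothing e) r ≡ true
accepts-max-pushed [] _ _ _ _ _ = refl , refl
accepts-max-pushed {v} {m} {e} {p} (c ∷ r) last m≤p p<v (c<v ∷ r<v) accepted =
  insertAfterRise-≥ v r (≤-trans (<⇒≤ c<m) m≤p) , (begin
    accepts (summary m nothing e) (c ∷ r)                              ≡⟨ accepts-below nothing e r c<m ⟩
    accepts (summary c (flushLast nothing e) nothing) r                ≡⟨ flush-pushed-max e r r<v ⟨
    accepts (summary c (flushLast nothing (pushEnds e v)) nothing) r   ≡⟨ accepts-below nothing (pushEnds e v) r c<m ⟨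
    accepts (summary m nothing (pushEnds e v)) (c ∷ r)                 ≡⟨ push ⟨
    accepts (summary m nothing e) (v ∷ c ∷ r)                          ≡⟨ accepted ⟩
    true ∎)
  where
  open ≡-Reasoning
  push = accepts-push nothing e (c ∷ r) (≤-trans m≤p (<⇒≤ p<v)) refl (aboveTop-lastRead last p<v)
  c<m = falling-is-new-minimum r (lastRead-push e v) c<v (trans (sym push) accepted)

accepts-insertAfterRise⁻ : ∀ {v m p q} r → m ≤ p → p < v → q < v → v ∈ r → All (_≤ v) r → Unique r →
  accepts (summary m nothing (just (p , q))) r ≡ true →
  ∃[ r' ] r ≡ insertAfterRise v p r' × accepts (summary m nothing (just (p , q))) r' ≡ true × v ∷ r' ↭ r
accepts-insertAfterRise⁻ (b ∷ r) m≤p p<v q<v (here refl) (_ ∷ r≤v) (b∉ ∷ u) accepted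
  with inserted , accepted′ ← accepts-max-pushed r (inj₂ (_ , refl)) m≤p p<v
                                 (strictly-below r r≤v (Unique[x∷xs]⇒x∉xs (b∉ ∷ u))) accepted =
  r , sym inserted , accepted′ , ↭-refl
accepts-insertAfterRise⁻ {v} {m} {p} {q} (b ∷ r) m≤p p<v q<v (there v∈r) (b≤v ∷ r≤v) (b∉ ∷ u) accepted
  with <-≤-connex b m
... | inj₁ b<m with pre , post , refl ← ∈-∃++ v∈r =
  contradiction (trans (sym accepted) (trans (accepts-below nothing (just (p , q)) (pre ++ v ∷ post) b<m)
      (late-maximum-rejected pre post b q nothing (strictly-below pre (All.++⁻ˡ pre r≤v) (unique⇒∉-prefix pre u)) q<v b<v tt)))
    λ ()
  where b<v = <-≤-trans b<m (≤-trans m≤p (<⇒≤ p<v))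
... | inj₂ m≤b with <-≤-connex p b
...   | inj₂ b≤p = contradiction (trans (sym accepted) (accepts-reject nothing (just (p , q)) r m≤b (≥⇒<ᵇ≡false b≤p))) λ ()
...   | inj₁ p<b
  with r' , inserted , accepted′ , r'↭ ←
         accepts-insertAfterRise⁻ r m≤b (≤∧≢⇒< b≤v (λ b≡v → All.lookup b∉ v∈r b≡v)) q<v v∈r r≤v u
           (trans (sym (accepts-push nothing (just (p , q)) r m≤b refl (<⇒<ᵇ≡true p<b))) accepted) =
  b ∷ r' , trans (cong (b ∷_) inserted) (sym (insertAfterRise-< v r' p<b)) , trans (push r') accepted′ ,
  ↭-trans (↭-swap v b ↭-refl) (↭-prep b r'↭)
  where
  push : ∀ xs → accepts (summary m nothing (just (p , q))) (b ∷ xs) ≡ accepts (summary m nothing (just (b , q))) xs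
  push xs = accepts-push nothing (just (p , q)) xs m≤b refl (<⇒<ᵇ≡true p<b)

data Site (parent τ : List ℕ) : ℕ → Set where
  front : descentRun τ ≡ suc (descentRun parent) → Site parent τ 0
  after : ∀ {j} → suc j ≤ descentRun parent → descentRun τ ≡ suc j → Site parent τ (suc j)

record Removal (v : ℕ) (τ : List ℕ) : Set where
  constructor removal
  field
    parent : List ℕ
    site : ℕ
    inserted : τ ≡ insertAt v site parent
    parent-good : good parent ≡ true
    parent-↭ : v ∷ parent ↭ τ
    site-run : Site parent τ site

removeMax : ∀ {v} τ → v ∈ τ → All (_≤ v) τ → Unique τ → good τ ≡ true → Removal v τ
removeMax (a ∷ r) (here refl) (_ ∷ r≤a) u g =
  removal r 0 refl good-r ↭-refl (front (proj₂ (cons-max-good r r<a good-r)))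
  where
  r<a = strictly-below r r≤a (Unique[x∷xs]⇒x∉xs u)
  good-r = trans (sym (good-∷-max r r<a)) g
removeMax {v} (a ∷ b ∷ r) (there v∈br) (a≤v ∷ br≤v) (_ ∷ ub) g with <-≤-connex b a
... | inj₁ b<a with removeMax (b ∷ r) v∈br br≤v ub (trans (sym (good-descent r b<a)) g)
...   | removal _ zero inserted _ _ _ = contradiction (∷-injectiveˡ inserted) (<⇒≢ (<-≤-trans b<a a≤v))
...   | removal [] (suc j) inserted _ _ _ = contradiction (∷-injectiveˡ inserted) (<⇒≢ (<-≤-trans b<a a≤v))
...   | removal (c ∷ τ') (suc j) inserted good′ ↭′ (after j≤run run≡) with X , e ← insertAt-suc-∷ v j c τ'
  with refl ← trans inserted e =
  removal (a ∷ c ∷ τ') (suc (suc j)) (cong (a ∷_) inserted) (trans (good-descent τ' b<a) good′)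
    (↭-trans (↭-swap v a ↭-refl) (↭-prep a ↭′))
    (after (subst (suc (suc j) ≤_) (sym (descentRun-< τ' b<a)) (s≤s j≤run)) (trans (descentRun-< r b<a) (cong suc run≡)))
removeMax {v} (a ∷ b ∷ r) (there (here refl)) (a≤v ∷ _ ∷ r≤v) ((a≢v ∷ _) ∷ ubr) g | inj₂ a≤b
  with inserted , good′ ← accepts-max-pushed r (inj₁ (refl , refl)) ≤-refl (≤∧≢⇒< a≤v a≢v)
                            (strictly-below r r≤v (Unique[x∷xs]⇒x∉xs ubr)) g =
  removal (a ∷ r) 1 (cong (a ∷_) (sym inserted)) good′ (↭-swap v a ↭-refl)
    (after (descentRun-positive a r) (descentRun-≥ r a≤b))
removeMax {v} (a ∷ b ∷ r) (there (there v∈r)) (_ ∷ b≤v ∷ r≤v) ((a≢b ∷ _) ∷ b∉ ∷ ur) g | inj₂ a≤b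
  with b<v ← ≤∧≢⇒< b≤v (λ b≡v → All.lookup b∉ v∈r b≡v)
  with r' , inserted , accepted , ↭′ ← accepts-insertAfterRise⁻ r a≤b b<v b<v v∈r r≤v ur
                                          (trans (sym (accepts-push nothing nothing r a≤b refl refl)) g) =
  removal (a ∷ b ∷ r') 1 (cong (a ∷_) (trans (cong (b ∷_) inserted) (sym (insertAfterRise-< v r' a<b))))
    (trans (push r') accepted)
    (↭-trans (↭-swap v a ↭-refl) (↭-prep a (↭-trans (↭-swap v b ↭-refl) (↭-prep b ↭′))))
    (after (descentRun-positive a (b ∷ r')) (descentRun-≥ r a≤b))
  where
  a<b = ≤∧≢⇒< a≤b a≢b
  push : ∀ xs → good (a ∷ b ∷ xs) ≡ accepts (summary a nothing (just (b , b))) xs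
  push xs = accepts-push nothing nothing xs a≤b refl refl

-- Enumeration by descent run

idPerm-suc : ∀ n → idPerm (suc n) ↭ suc n ∷ idPerm n
idPerm-suc n = subst (_↭ suc n ∷ idPerm n) snoc (↭-sym (∷↭∷ʳ (suc n) (idPerm n)))
  where
  snoc : idPerm n ∷ʳ suc n ≡ idPerm (suc n)
  snoc = trans (sym (map-++ suc (upTo n) [ n ])) (cong (map suc) (upTo-∷ʳ n))

↭-idPerm⇒bounded : ∀ {n τ} → τ ↭ idPerm n → All (_≤ n) τ
↭-idPerm⇒bounded p = All.tabulate (λ z∈ → proj₂ (∈-idPerm⁻ (∈-resp-↭ p z∈)))

↭-idPerm⇒unique : ∀ {n τ} → τ ↭ idPerm n → Unique τ
↭-idPerm⇒unique {n} p = unique-resp-↭ (↭-sym p) (idPerm-unique n)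

↭-idPerm⇒length : ∀ {n τ} → τ ↭ idPerm n → length τ ≡ n
↭-idPerm⇒length {n} p = trans (↭-length p) (trans (length-map suc (upTo n)) (length-upTo n))

↭-idPerm⇒descentRun≤ : ∀ {n τ} → τ ↭ idPerm n → descentRun τ ≤ n
↭-idPerm⇒descentRun≤ {τ = τ} p = subst (descentRun τ ≤_) (↭-idPerm⇒length p) (descentRun-≤-length τ)

GoodPerm : ℕ → List ℕ → Set
GoodPerm n τ = τ ↭ idPerm n × good τ ≡ true

concatFrom : ∀ {A : Set} → (ℕ → List A) → ℕ → ℕ → List A
concatFrom F j zero = []
concatFrom F j (suc c) = F j ++ concatFrom F (suc j) c

∈-concatFrom⁻ : ∀ {A : Set} (F : ℕ → List A) {τ} j c → τ ∈ concatFrom F j c → ∃[ k ] j ≤ k × τ ∈ F k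
∈-concatFrom⁻ F j (suc c) τ∈ with ∈-++⁻ (F j) τ∈
... | inj₁ τ∈F = j , ≤-refl , τ∈F
... | inj₂ τ∈rest with k , j<k , τ∈F ← ∈-concatFrom⁻ F (suc j) c τ∈rest = k , <⇒≤ j<k , τ∈F

∈-concatFrom⁺ : ∀ {A : Set} (F : ℕ → List A) {τ k} j c → j ≤ k → k < j + c → τ ∈ F k → τ ∈ concatFrom F j c
∈-concatFrom⁺ F j zero j≤k k<j+0 _ = contradiction (subst (_ <_) (+-identityʳ j) k<j+0) (≤⇒≯ j≤k)
∈-concatFrom⁺ F {k = k} j (suc c) j≤k k<j+c τ∈F with m≤n⇒m<n∨m≡n j≤k
... | inj₂ refl = ∈-++⁺ˡ τ∈F
... | inj₁ j<k = ∈-++⁺ʳ (F j) (∈-concatFrom⁺ F (suc j) c j<k (subst (k <_) (+-suc j c) k<j+c) τ∈F)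

goodByRun : ℕ → ℕ → List (List ℕ)
goodByRun zero zero = [ [] ]
goodByRun zero (suc k) = []
goodByRun (suc n) zero = []
goodByRun (suc n) (suc j) =
  map (suc n ∷_) (goodByRun n j) ++ map (insertAt (suc n) (suc j)) (concatFrom (goodByRun n) (suc j) (suc n))

goodByRunFrom : ℕ → ℕ → List (List ℕ)
goodByRunFrom n j = concatFrom (goodByRun n) j (suc n)

mutual
  ∈-goodByRun⁻ : ∀ n k {τ} → τ ∈ goodByRun n k → GoodPerm n τ × descentRun τ ≡ k
  ∈-goodByRun⁻ zero zero (here refl) = (↭-refl , refl) , refl
  ∈-goodByRun⁻ (suc n) (suc j) τ∈ with ∈-++⁻ (map (suc n ∷_) (goodByRun n j)) τ∈
  ... | inj₁ τ∈front with τ' , τ'∈ , refl ← ∈-map⁻ (suc n ∷_) τ∈front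
    with (p , g) , run ← ∈-goodByRun⁻ n j τ'∈
    with g′ , run′ ← cons-max-good τ' (All.map s≤s (↭-idPerm⇒bounded p)) g =
    (↭-trans (↭-prep (suc n) p) (↭-sym (idPerm-suc n)) , g′) , trans run′ (cong suc run)
  ∈-goodByRun⁻ (suc n) (suc j) τ∈ | inj₂ τ∈after with τ' , τ'∈ , refl ← ∈-map⁻ (insertAt (suc n) (suc j)) τ∈after
    with (p , g) , j≤run ← ∈-goodByRunFrom⁻ n (suc j) τ'∈
    with g′ , run′ ← insertAt-good j τ' (↭-idPerm⇒unique p) (All.map s≤s (↭-idPerm⇒bounded p)) g j≤run =
    (↭-trans (insertAt-↭ (suc n) (suc j) τ') (↭-trans (↭-prep (suc n) p) (↭-sym (idPerm-suc n))) , g′) , run′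

  ∈-goodByRunFrom⁻ : ∀ n j {τ} → τ ∈ goodByRunFrom n j → GoodPerm n τ × j ≤ descentRun τ
  ∈-goodByRunFrom⁻ n j τ∈ with k , j≤k , τ∈k ← ∈-concatFrom⁻ (goodByRun n) j (suc n) τ∈
    with good , run ← ∈-goodByRun⁻ n k τ∈k = good , subst (j ≤_) (sym run) j≤k

mutual
  ∈-goodByRun⁺ : ∀ n k {τ} → GoodPerm n τ → descentRun τ ≡ k → τ ∈ goodByRun n k
  ∈-goodByRun⁺ zero k (p , _) run with refl ← ↭-empty-inv p with refl ← run = here refl
  ∈-goodByRun⁺ (suc n) zero {[]} (p , _) _ = contradiction (↭-sym p) ¬x∷xs↭[]
  ∈-goodByRun⁺ (suc n) zero {a ∷ r} _ run = contradiction (subst (1 ≤_) run (descentRun-positive a r)) λ ()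
  ∈-goodByRun⁺ (suc n) (suc j) {τ} (p , g) run
    with removal τ' site inserted g′ ↭′ siteRun ←
           removeMax τ (∈-resp-↭ (↭-sym p) (∈-resp-↭ (↭-sym (idPerm-suc n)) (here refl)))
                                                   (↭-idPerm⇒bounded p) (↭-idPerm⇒unique p) g
    with p′ ← drop-∷ (↭-trans ↭′ (↭-trans p (idPerm-suc n)))
    with siteRun
  ... | front run≡ rewrite inserted =
    ∈-++⁺ˡ (∈-map⁺ (suc n ∷_) (∈-goodByRun⁺ n j (p′ , g′) (suc-injective (trans (sym run≡) run))))
  ... | after j≤run run≡ with refl ← trans (sym run≡) run rewrite inserted =
    ∈-++⁺ʳ (map (suc n ∷_) (goodByRun n j))
      (∈-map⁺ (insertAt (suc n) (suc j)) (∈-goodByRunFrom⁺ n (suc j) (p′ , g′) j≤run))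

  ∈-goodByRunFrom⁺ : ∀ n j {τ} → GoodPerm n τ → j ≤ descentRun τ → τ ∈ goodByRunFrom n j
  ∈-goodByRunFrom⁺ n j {τ} good j≤run =
    ∈-concatFrom⁺ (goodByRun n) j (suc n) j≤run
      (subst (descentRun τ <_) (sym (+-suc j n)) (s≤s (≤-trans (↭-idPerm⇒descentRun≤ (proj₁ good)) (m≤n+m n j))))
      (∈-goodByRun⁺ n (descentRun τ) good refl)

erase : ℕ → List ℕ → List ℕ
erase v [] = []
erase v (x ∷ xs) with x ≟ v
... | yes _ = xs
... | no _ = x ∷ erase v xs

erase-here : ∀ v xs → erase v (v ∷ xs) ≡ xs
erase-here v xs with v ≟ v
... | yes _ = refl
... | no v≢v = contradiction refl v≢v

erase-there : ∀ {v x} xs → x ≢ v → erase v (x ∷ xs) ≡ x ∷ erase v xs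
erase-there {v} {x} xs x≢v with x ≟ v
... | yes x≡v = contradiction x≡v x≢v
... | no _ = refl

erase-insertAfterRise : ∀ v p r → v ∉ r → erase v (insertAfterRise v p r) ≡ r
erase-insertAfterRise v p [] _ = erase-here v []
erase-insertAfterRise v p (b ∷ r) v∉ with <-≤-connex p b
... | inj₁ p<b rewrite insertAfterRise-< v r p<b =
  trans (erase-there _ (λ b≡v → v∉ (here (sym b≡v)))) (cong (b ∷_) (erase-insertAfterRise v b r (λ v∈ → v∉ (there v∈))))
... | inj₂ b≤p rewrite insertAfterRise-≥ v r b≤p = erase-here v (b ∷ r)

erase-insertAt : ∀ v j τ → v ∉ τ → erase v (insertAt v j τ) ≡ τ
erase-insertAt v zero τ _ = erase-here v τ
erase-insertAt v (suc j) [] _ = erase-here v []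
erase-insertAt v (suc zero) (a ∷ r) v∉ =
  trans (erase-there _ (λ a≡v → v∉ (here (sym a≡v)))) (cong (a ∷_) (erase-insertAfterRise v a r (λ v∈ → v∉ (there v∈))))
erase-insertAt v (suc (suc j)) (a ∷ r) v∉ =
  trans (erase-there _ (λ a≡v → v∉ (here (sym a≡v)))) (cong (a ∷_) (erase-insertAt v (suc j) r (λ v∈ → v∉ (there v∈))))

unique-map⁺ : ∀ {A B : Set} (f : A → B) {xs} → (∀ {x y} → x ∈ xs → y ∈ xs → f x ≡ f y → x ≡ y) →
              Unique xs → Unique (map f xs)
unique-map⁺ f {[]} _ [] = []
unique-map⁺ f {x ∷ xs} injective (x∉ ∷ u) =
  All.map⁺ (All.tabulate (λ y∈ fx≡fy → All.lookup x∉ y∈ (injective (here refl) (there y∈) fx≡fy)))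
  ∷ unique-map⁺ f (λ x∈ y∈ → injective (there x∈) (there y∈)) u

unique-concatFrom : ∀ {A : Set} (F : ℕ → List A) (key : A → ℕ) → (∀ k → Unique (F k)) →
                    (∀ k {τ} → τ ∈ F k → key τ ≡ k) → ∀ j c → Unique (concatFrom F j c)
unique-concatFrom F key unique keyed j zero = []
unique-concatFrom F key unique keyed j (suc c) =
  Uniqueₚ.++⁺ (unique j) (unique-concatFrom F key unique keyed (suc j) c) disjoint
  where
  disjoint : Disjoint (F j) (concatFrom F (suc j) c)
  disjoint (τ∈j , τ∈rest) with k , j<k , τ∈k ← ∈-concatFrom⁻ F (suc j) c τ∈rest =
    <-irrefl (trans (sym (keyed j τ∈j)) (keyed k τ∈k)) j<k

mutual
  goodByRun-unique : ∀ n k → Unique (goodByRun n k)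
  goodByRun-unique zero zero = [] ∷ []
  goodByRun-unique zero (suc k) = []
  goodByRun-unique (suc n) zero = []
  goodByRun-unique (suc n) (suc j) =
    Uniqueₚ.++⁺ (Uniqueₚ.map⁺ ∷-injectiveʳ (goodByRun-unique n j))
                (unique-map⁺ (insertAt (suc n) (suc j)) injective (goodByRunFrom-unique n (suc j))) disjoint
    where
    max∉ : ∀ {τ} → τ ∈ goodByRunFrom n (suc j) → suc n ∉ τ
    max∉ τ∈ = <-irrefl refl ∘ All.lookup (All.map s≤s (↭-idPerm⇒bounded (proj₁ (proj₁ (∈-goodByRunFrom⁻ n (suc j) τ∈)))))
    injective : ∀ {τ τ'} → τ ∈ goodByRunFrom n (suc j) → τ' ∈ goodByRunFrom n (suc j) →
                insertAt (suc n) (suc j) τ ≡ insertAt (suc n) (suc j) τ' → τ ≡ τ'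
    injective {τ} {τ'} τ∈ τ'∈ e = begin
      τ                                               ≡⟨ erase-insertAt (suc n) (suc j) τ (max∉ τ∈) ⟨
      erase (suc n) (insertAt (suc n) (suc j) τ)      ≡⟨ cong (erase (suc n)) e ⟩
      erase (suc n) (insertAt (suc n) (suc j) τ')     ≡⟨ erase-insertAt (suc n) (suc j) τ' (max∉ τ'∈) ⟩
      τ' ∎
      where open ≡-Reasoning
    disjoint : Disjoint (map (suc n ∷_) (goodByRun n j)) (map (insertAt (suc n) (suc j)) (goodByRunFrom n (suc j)))
    disjoint (τ∈front , τ∈after) with _ , _ , refl ← ∈-map⁻ (suc n ∷_) τ∈front
      with ∈-map⁻ (insertAt (suc n) (suc j)) τ∈after
    ... | [] , τ'∈ , _ = contradiction (proj₂ (∈-goodByRunFrom⁻ n (suc j) τ'∈)) λ ()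
    ... | c ∷ r , τ'∈ , e with X , e′ ← insertAt-suc-∷ (suc n) j c r with refl ← trans e e′ =
      max∉ τ'∈ (here refl)

  goodByRunFrom-unique : ∀ n j → Unique (goodByRunFrom n j)
  goodByRunFrom-unique n j =
    unique-concatFrom (goodByRun n) descentRun (goodByRun-unique n) (λ k τ∈ → proj₂ (∈-goodByRun⁻ n k τ∈)) j (suc n)

-- Counting

countRun countRunFrom : ℕ → ℕ → ℕ
countRun n k = length (goodByRun n k)
countRunFrom n j = length (goodByRunFrom n j)

length-empty : ∀ {A : Set} (xs : List A) → (∀ {x} → x ∉ xs) → length xs ≡ 0
length-empty [] _ = refl
length-empty (x ∷ xs) x∉ = contradiction (here refl) x∉

countRun-above : ∀ n k → n < k → countRun n k ≡ 0
countRun-above n k n<k = length-empty (goodByRun n k) λ τ∈ →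
  let (p , _) , run = ∈-goodByRun⁻ n k τ∈ in <⇒≱ n<k (subst (_≤ n) run (↭-idPerm⇒descentRun≤ p))

countRunFrom-above : ∀ n j → n < j → countRunFrom n j ≡ 0
countRunFrom-above n j n<j = length-empty (goodByRunFrom n j) λ τ∈ →
  let (p , _) , j≤run = ∈-goodByRunFrom⁻ n j τ∈ in <⇒≱ n<j (≤-trans j≤run (↭-idPerm⇒descentRun≤ p))

countRun-suc : ∀ n j → countRun (suc n) (suc j) ≡ countRun n j + countRunFrom n (suc j)
countRun-suc n j = trans (length-++ (map (suc n ∷_) (goodByRun n j)))
  (cong₂ _+_ (length-map (suc n ∷_) (goodByRun n j)) (length-map (insertAt (suc n) (suc j)) (goodByRunFrom n (suc j))))

length-concatFrom-suc : ∀ {A : Set} (F : ℕ → List A) j c →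
                        length (concatFrom F j (suc c)) ≡ length (concatFrom F j c) + length (F (j + c))
length-concatFrom-suc F j zero rewrite +-identityʳ j = trans (length-++ (F j)) (+-identityʳ _)
length-concatFrom-suc F j (suc c) = begin
  length (F j ++ concatFrom F (suc j) (suc c))                          ≡⟨ length-++ (F j) ⟩
  length (F j) + length (concatFrom F (suc j) (suc c))                  ≡⟨ cong (length (F j) +_) (length-concatFrom-suc F (suc j) c) ⟩
  length (F j) + (length (concatFrom F (suc j) c) + length (F (suc j + c)))
    ≡⟨ +-assoc (length (F j)) _ _ ⟨
  length (F j) + length (concatFrom F (suc j) c) + length (F (suc j + c))
    ≡⟨ cong₂ _+_ (length-++ (F j)) (cong (length ∘ F) (+-suc j c)) ⟨
  length (concatFrom F j (suc c)) + length (F (j + suc c)) ∎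
  where open ≡-Reasoning

countRunFrom-suc : ∀ n j → countRunFrom n j ≡ countRun n j + countRunFrom n (suc j)
countRunFrom-suc n j = trans (length-++ (goodByRun n j)) (cong (countRun n j +_) (sym dropLast))
  where
  dropLast : countRunFrom n (suc j) ≡ length (concatFrom (goodByRun n) (suc j) n)
  dropLast = trans (length-concatFrom-suc (goodByRun n) (suc j) n)
    (trans (cong (length (concatFrom (goodByRun n) (suc j) n) +_) (countRun-above n (suc j + n) (s≤s (m≤n+m n j))))
           (+-identityʳ _))

countRun-diagonal : ∀ j → countRun j j ≡ 1
countRun-diagonal zero = refl
countRun-diagonal (suc j) = trans (countRun-suc j j) (cong₂ _+_ (countRun-diagonal j) (countRunFrom-above j (suc j) ≤-refl))

ballot : ℕ → ℕ → ℕ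
ballot j i = countRunFrom (j + i) j

ballot-suc : ∀ j i → ballot (suc j) (suc i) ≡ ballot j (suc i) + ballot (suc (suc j)) i
ballot-suc j i = begin
  countRunFrom (suc (j + suc i)) (suc j)
    ≡⟨ countRunFrom-suc (suc (j + suc i)) (suc j) ⟩
  countRun (suc (j + suc i)) (suc j) + countRunFrom (suc (j + suc i)) (suc (suc j))
    ≡⟨ cong (_+ countRunFrom (suc (j + suc i)) (suc (suc j)))
            (trans (countRun-suc (j + suc i) j) (sym (countRunFrom-suc (j + suc i) j))) ⟩
  countRunFrom (j + suc i) j + countRunFrom (suc (j + suc i)) (suc (suc j))
    ≡⟨ cong (λ n → countRunFrom (j + suc i) j + countRunFrom (suc n) (suc (suc j))) (+-suc j i) ⟩
  ballot j (suc i) + ballot (suc (suc j)) i ∎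
  where open ≡-Reasoning

ballot-zero : ∀ j → ballot j 0 ≡ 1
ballot-zero j rewrite +-identityʳ j =
  trans (countRunFrom-suc j j) (cong₂ _+_ (countRun-diagonal j) (countRunFrom-above j (suc j) ≤-refl))

ballot-first : ∀ i → ballot 0 (suc i) ≡ ballot 1 i
ballot-first i = countRunFrom-suc (suc i) 0

binomial : ℕ → ℕ → ℕ
binomial m zero = 1
binomial zero (suc k) = 0
binomial (suc m) (suc k) = binomial m k + binomial m (suc k)

-- binomial N (i ∸ 1), except that it vanishes at i = 0
binomialPred : ℕ → ℕ → ℕ
binomialPred N zero = 0
binomialPred N (suc i) = binomial N i

binomial≡C : ∀ m k → binomial m k ≡ m C k
binomial≡C m zero = refl
binomial≡C zero (suc k) = refl
binomial≡C (suc m) (suc k) = trans (cong₂ _+_ (binomial≡C m k) (binomial≡C m (suc k))) (nCk+nC[k+1]≡[n+1]C[k+1] m k)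

binomial-pascal : ∀ N i → binomial (suc N) i ≡ binomialPred N i + binomial N i
binomial-pascal N zero = refl
binomial-pascal N (suc i) = refl

binomial-above : ∀ n k → n < k → binomial n k ≡ 0
binomial-above zero (suc k) _ = refl
binomial-above (suc n) (suc k) (s≤s n<k) = cong₂ _+_ (binomial-above n k n<k) (binomial-above n (suc k) (<-trans n<k (n<1+n k)))

binomial-diagonal : ∀ n → binomial n n ≡ 1
binomial-diagonal zero = refl
binomial-diagonal (suc n) = cong₂ _+_ (binomial-diagonal n) (binomial-above n (suc n) (n<1+n n))

binomial-symmetric : ∀ a b → binomial (a + b) a ≡ binomial (a + b) b
binomial-symmetric zero b = sym (binomial-diagonal b)
binomial-symmetric (suc a) zero rewrite +-identityʳ a = binomial-diagonal (suc a)
binomial-symmetric (suc a) (suc b) =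
  trans (cong₂ _+_ (binomial-symmetric a (suc b)) shifted) (+-comm (binomial (a + suc b) (suc b)) (binomial (a + suc b) b))
  where
  shifted : binomial (a + suc b) (suc a) ≡ binomial (a + suc b) b
  shifted = subst (λ N → binomial N (suc a) ≡ binomial N b) (sym (+-suc a b)) (binomial-symmetric (suc a) b)

ballot+binomialPred≡binomial : ∀ i j → ballot j i + binomialPred (j + (i + i)) i ≡ binomial (j + (i + i)) i
ballot+binomialPred≡binomial zero j = trans (+-identityʳ (ballot j 0)) (ballot-zero j)
ballot+binomialPred≡binomial (suc i) (suc j) = begin
  ballot (suc j) (suc i) + binomial (suc M) i
    ≡⟨ cong₂ _+_ (ballot-suc j i) (binomial-pascal M i) ⟩
  (ballot j (suc i) + ballot (suc (suc j)) i) + (binomialPred M i + binomial M i)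
    ≡⟨ solve 4 (λ a b c d → (a :+ b) :+ (c :+ d) := (a :+ d) :+ (b :+ c)) refl
             (ballot j (suc i)) (ballot (suc (suc j)) i) (binomialPred M i) (binomial M i) ⟩
  (ballot j (suc i) + binomial M i) + (ballot (suc (suc j)) i + binomialPred M i)
    ≡⟨ cong₂ _+_ (ballot+binomialPred≡binomial (suc i) j) shifted ⟩
  binomial M (suc i) + binomial M i
    ≡⟨ +-comm (binomial M (suc i)) (binomial M i) ⟩
  binomial M i + binomial M (suc i) ∎
  where
  open ≡-Reasoning
  open +-*-Solver
  M = j + (suc i + suc i)
  M≡ : suc (suc j) + (i + i) ≡ M
  M≡ = sym (trans (+-suc j (i + suc i)) (cong suc (trans (cong (j +_) (+-suc i i)) (+-suc j (i + i)))))
  shifted : ballot (suc (suc j)) i + binomialPred M i ≡ binomial M i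
  shifted = subst (λ N → ballot (suc (suc j)) i + binomialPred N i ≡ binomial N i) M≡
                  (ballot+binomialPred≡binomial i (suc (suc j)))
ballot+binomialPred≡binomial (suc i) zero = begin
  ballot 0 (suc i) + binomial (suc K) i                ≡⟨ cong₂ _+_ (ballot-first i) (binomial-pascal K i) ⟩
  ballot 1 i + (binomialPred K i + binomial K i)       ≡⟨ +-assoc (ballot 1 i) (binomialPred K i) (binomial K i) ⟨
  (ballot 1 i + binomialPred K i) + binomial K i
    ≡⟨ cong (_+ binomial K i) (subst (λ N → ballot 1 i + binomialPred N i ≡ binomial N i) (sym (+-suc i i))
                                     (ballot+binomialPred≡binomial i 1)) ⟩
  binomial K i + binomial K i                          ≡⟨ cong (binomial K i +_) (binomial-symmetric i (suc i)) ⟩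
  binomial K i + binomial K (suc i) ∎
  where
  open ≡-Reasoning
  K = i + suc i

binomial-absorb : ∀ m k → suc k * binomial (suc m) (suc k) ≡ suc m * binomial m k
binomial-absorb zero zero = refl
binomial-absorb zero (suc k) = *-zeroʳ (suc (suc k))
binomial-absorb (suc m) zero = begin
  1 * (1 + binomial (suc m) 1)      ≡⟨ *-identityˡ _ ⟩
  1 + binomial (suc m) 1            ≡⟨ cong suc (trans (sym (*-identityˡ _)) (trans (binomial-absorb m zero) (*-identityʳ (suc m)))) ⟩
  suc (suc m)                       ≡⟨ *-identityʳ (suc (suc m)) ⟨
  suc (suc m) * 1 ∎
  where open ≡-Reasoning
binomial-absorb (suc m) (suc k) = begin
  suc (suc k) * ((b + c) + d)
    ≡⟨ solve 4 (λ k b c d → (con 2 :+ k) :* ((b :+ c) :+ d) := (b :+ c) :+ (((con 1 :+ k) :* (b :+ c)) :+ ((con 2 :+ k) :* d)))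
             refl k b c d ⟩
  (b + c) + (suc k * (b + c) + suc (suc k) * d)
    ≡⟨ cong ((b + c) +_) (cong₂ _+_ (binomial-absorb m k) (binomial-absorb m (suc k))) ⟩
  (b + c) + (suc m * b + suc m * c)
    ≡⟨ solve 3 (λ m b c → (b :+ c) :+ (((con 1 :+ m) :* b) :+ ((con 1 :+ m) :* c)) := (con 2 :+ m) :* (b :+ c)) refl m b c ⟩
  suc (suc m) * (b + c) ∎
  where
  open ≡-Reasoning
  open +-*-Solver
  b = binomial m k
  c = binomial m (suc k)
  d = binomial (suc m) (suc (suc k))

binomial-central-ratio : ∀ k → suc k * binomial (suc (k + suc k)) (suc k) ≡ suc (suc k) * binomial (suc (k + suc k)) k
binomial-central-ratio k = +-cancelˡ-≡ (suc k * x) (suc k * y) (suc (suc k) * x) (begin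
  suc k * x + suc k * y         ≡⟨ *-distribˡ-+ (suc k) x y ⟨
  suc k * (x + y)               ≡⟨ binomial-absorb N k ⟩
  suc N * x                     ≡⟨ cong (_* x) (cong (λ w → suc (suc w)) (+-suc k k)) ⟩
  (3 + (k + k)) * x             ≡⟨ solve 2 (λ k x → (con 3 :+ (k :+ k)) :* x := ((con 1 :+ k) :* x) :+ ((con 2 :+ k) :* x)) refl k x ⟩
  suc k * x + suc (suc k) * x ∎)
  where
  open ≡-Reasoning
  open +-*-Solver
  N = suc (k + suc k)
  x = binomial N k
  y = binomial N (suc k)

countRunFrom-0*[1+n]≡central : ∀ n → countRunFrom n 0 * suc n ≡ binomial (n + n) n
countRunFrom-0*[1+n]≡central zero = refl
countRunFrom-0*[1+n]≡central (suc k) = +-cancelʳ-≡ (suc (suc k) * x) (z * suc (suc k)) y (begin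
  z * suc (suc k) + suc (suc k) * x
    ≡⟨ solve 3 (λ z k x → z :* (con 2 :+ k) :+ (con 2 :+ k) :* x := (con 2 :+ k) :* (z :+ x)) refl z k x ⟩
  suc (suc k) * (z + x)               ≡⟨ cong (suc (suc k) *_) (ballot+binomialPred≡binomial (suc k) 0) ⟩
  suc (suc k) * y                     ≡⟨ solve 2 (λ k y → (con 2 :+ k) :* y := y :+ (con 1 :+ k) :* y) refl k y ⟩
  y + suc k * y                       ≡⟨ cong (y +_) (binomial-central-ratio k) ⟩
  y + suc (suc k) * x ∎)
  where
  open ≡-Reasoning
  open +-*-Solver
  N = suc (k + suc k)
  x = binomial N k
  y = binomial N (suc k)
  z = countRunFrom (suc k) 0

countRunFrom-0≡catalan : ∀ n → countRunFrom n 0 ≡ catalan n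
countRunFrom-0≡catalan n = begin
  countRunFrom n 0                            ≡⟨ m*n/n≡m (countRunFrom n 0) (suc n) ⟨
  countRunFrom n 0 * suc n / suc n            ≡⟨ cong (_/ suc n) (trans (countRunFrom-0*[1+n]≡central n) (binomial≡C (n + n) n)) ⟩
  catalan n ∎
  where open ≡-Reasoning

mainTheorem20 : (n : ℕ) → n ≥ 1 →
    Σ (List (List ℕ)) (λ L → Unique L ×
      ((τ : List ℕ) → τ ∈ L ⇔ ((τ ↭ idPerm n) × (westSort (stackMap pat1-32 τ) ≡ idPerm n))) ×
      length L ≡ catalan n)
mainTheorem20 (suc n) _ =
  goodByRunFrom (suc n) 0 , goodByRunFrom-unique (suc n) 0 , members , countRunFrom-0≡catalan (suc n)
  where
  members : (τ : List ℕ) →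
            τ ∈ goodByRunFrom (suc n) 0 ⇔ ((τ ↭ idPerm (suc n)) × (westSort (stackMap pat1-32 τ) ≡ idPerm (suc n)))
  members τ = mk⇔
    (λ τ∈ → let (p , g) , _ = ∈-goodByRunFrom⁻ (suc n) 0 τ∈ in p , Equivalence.from (sortable⇔good n τ p) g)
    (λ (p , sorts) → ∈-goodByRunFrom⁺ (suc n) 0 (p , Equivalence.to (sortable⇔good n τ p) sorts) z≤n)
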